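{- Let $0\le r\le m\le n$ and $3\le k\le n$ be integers, let $S$ be a totally ordered set with $|S|=n$, and let $C$ be a division of $S$ with $(|C_1|,\dots,|C_n|)=(n-m,0^{k-3},r,m-r,0^{n-k})$. Let $w_0=\lambda\notin S$ be an element adjoined to the order with $\lambda>s$ for all $s\in C_{k-1}$ and $\lambda<s$ for all $s\in C_k$. Then a permutation $w=w_1\dots w_n$ of $S$ is a $C$-permutation if and only if the sequence $w_0,w_1,\dots,w_n$ satisfies: (a) if $i<j$ and $w_i,w_j\in C_1$, then $w_i<w_j$; (b) the sequence has at least $k-1$ $C_1$-descents; (c) if $w_i$ is the $(k-1)$-th $C_1$-descent (in left-to-right order), then $w_{i+1},w_{i+2},\dots,w_n$ is increasing.
   Context: $0^l$ denotes $l$ zeros. For a sequence $s_1,s_2,\dots$, a term $s_i$ is a $C_1$-descent if either $s_i\in C_1$, or there exists $j>i$ with $s_j\notin C_1$, $s_i>s_j$, and $s_l\in C_1$ for every $i<l<j$. A division of $S$ is a sequence $C=(C_1,\dots,C_n)$ of pairwise disjoint (possibly empty) sets with union $S$ and $s<t$ whenever $s\in C_i,t\in C_j,i<j$. An element $s$ is admissible w.r.t. a division $D=(D_1,\dots,D_N)$ if it is the smallest element of $D_1$, the largest element of $D_N$, or lies in $D_i$ with $i\ne1,N$. For admissible $s\in D_i$, with $D_i^-=\{t\in D_i:t<s\}$, $D_i^+=\{t\in D_i:t>s\}$, the deletion $D^s$ is: if $i=1$, $(D_1^+\cup D_2,D_3,\dots,D_N)$; if $i\ne1,N$, $(D_1,\dots,D_{i-2},D_{i-1}\cup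 D_i^-,D_i^+\cup D_{i+1},D_{i+2},\dots,D_N)$; if $i=N$, $(D_1,\dots,D_{N-2},D_{N-1}\cup D_N^-)$. A $C$-permutation is an ordering $w_1\dots w_n$ of $S$ such that $w_1$ is admissible w.r.t. $C$, $w_2$ w.r.t. $C^{w_1}$, $w_3$ w.r.t. $(C^{w_1})^{w_2}$, and so on. -}

module Defs where

open import Data.Nat using (ℕ; zero; suc; _+_; _∸_; _≤_; _<_; _<?_)
open import Data.List using (List; []; _∷_; _++_; map; upTo; replicate; filter; length)
open import Data.List.Membership.Propositional using (_∈_)
open import Data.Maybe using (Maybe; just; nothing)
open import Data.Vec using (Vec; lookup) renaming (_∷_ to _∷ᵥ_; map to mapᵥ)
open import Data.Fin using (Fin) renaming (_<_ to _<ᶠ_)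
open import Data.Empty using (⊥)
open import Data.Product using (Σ; _×_; ∃)
open import Data.Sum using (_⊎_)
open import Relation.Nullary using (¬_)
open import Relation.Binary.PropositionalEquality using (_≡_)
open import Function.Definitions using (Injective)

-- The totally ordered set S of size n is {0,…,n-1} ⊂ ℕ.
-- A division (D₁,…,D_N) is a list of blocks; each block is a finite
-- set represented by a list of its elements (the order inside a block
-- is irrelevant: only membership is ever used).

Division : Set
Division = List (List ℕ)

-- the i-th block (0-based; block D 0 is D₁); empty if out of range
block : Division → ℕ → List ℕ
block []      _       = []
block (B ∷ D) zero    = B
block (B ∷ D) (suc i) = block D i

below : ℕ → List ℕ → List ℕ
below s B = filter (_<? s) B

above : ℕ → List ℕ → List ℕ
above s B = filter (s <?_) B

data Adm (D : Division) (s : ℕ) : ℕ → Set where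
  first : s ∈ block D 0 → (∀ t → t ∈ block D 0 → s ≤ t) → Adm D s 0
  last  : ∀ {i} → suc i ≡ length D → s ∈ block D i →
          (∀ t → t ∈ block D i → t ≤ s) → Adm D s i
  mid   : ∀ {i} → 0 < i → suc i < length D → s ∈ block D i → Adm D s i

-- deletion D^s, where s lies in the block with 0-based index i.
-- delAt prev rest j s : prev is the block just before the remaining
-- blocks `rest`, and s lies in block j of `rest`.
delAt : List ℕ → Division → ℕ → ℕ → Division
delAt prev []             _       s = prev ∷ []
delAt prev (B ∷ [])       zero    s = (prev ++ below s B) ∷ []
delAt prev (B ∷ B' ∷ Ds)  zero    s =
  (prev ++ below s B) ∷ (above s B ++ B') ∷ Ds
delAt prev (B ∷ Ds)       (suc j) s = prev ∷ delAt B Ds j s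

del : Division → ℕ → ℕ → Division
del []            _       s = []
del (B ∷ [])      zero    s = above s B ∷ []
del (B ∷ B' ∷ Ds) zero    s = (above s B ++ B') ∷ Ds
del (B ∷ Ds)      (suc i) s = delAt B Ds i s

-- w is a C-permutation (w is additionally assumed to be an ordering of S)
data IsCPerm : Division → List ℕ → Set where
  []  : ∀ {D} → IsCPerm D []
  _∷_ : ∀ {D s i w} → Adm D s i → IsCPerm (del D i s) w → IsCPerm D (s ∷ w)

range : ℕ → ℕ → List ℕ
range a len = map (a +_) (upTo len)

divC : ℕ → ℕ → ℕ → ℕ → Division
divC n m r k =
  range 0 (n ∸ m) ∷
  (replicate (k ∸ 3) [] ++
   (range (n ∸ m) r ∷ range (n ∸ m + r) (m ∸ r) ∷ replicate (n ∸ k) []))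

-- Elements: just s (s ∈ S) or
-- nothing (= λ).  t = n - m + r is the least element of C_k; λ is
-- placed above every s < t (in particular above C_{k-1}) and below
-- every s ≥ t (i.e. below C_k).

Ext : Set
Ext = Maybe ℕ

_<[_]_ : Ext → ℕ → Ext → Set
just a  <[ t ] just b  = a < b
just a  <[ t ] nothing = a < t
nothing <[ t ] just b  = t ≤ b
nothing <[ t ] nothing = ⊥

InC1 : ℕ → Ext → Set
InC1 c (just a) = a < c
InC1 c nothing  = ⊥

seqλ : ∀ {n} → Vec ℕ n → Vec Ext (suc n)
seqλ w = nothing ∷ᵥ mapᵥ just w

IsC1Descent : ∀ {L} → ℕ → ℕ → Vec Ext L → Fin L → Set
IsC1Descent c t x i =
  InC1 c (lookup x i) ⊎
  Σ _ λ j → i <ᶠ j × ¬ InC1 c (lookup x j) × (lookup x j <[ t ] lookup x i)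
            × (∀ l → i <ᶠ l → l <ᶠ j → InC1 c (lookup x l))

CondA : ∀ {L} → ℕ → ℕ → Vec Ext L → Set
CondA c t x = ∀ i j → i <ᶠ j → InC1 c (lookup x i) → InC1 c (lookup x j) →
              lookup x i <[ t ] lookup x j

AtLeastDescents : ∀ {L} → ℕ → ℕ → ℕ → Vec Ext L → Set
AtLeastDescents d c t x =
  Σ (Fin d → Fin _) λ f → Injective _≡_ _≡_ f × (∀ u → IsC1Descent c t x (f u))

ExactlyDescentsBefore : ∀ {L} → ℕ → ℕ → ℕ → Vec Ext L → Fin L → Set
ExactlyDescentsBefore e c t x i =
  Σ (Fin e → Fin _) λ f → Injective _≡_ _≡_ f
    × (∀ u → IsC1Descent c t x (f u) × f u <ᶠ i)
    × (∀ j → IsC1Descent c t x j → j <ᶠ i → ∃ λ u → f u ≡ j)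

CondC : ∀ {L} → ℕ → ℕ → ℕ → Vec Ext L → Set
CondC d c t x = ∀ i → IsC1Descent c t x i → ExactlyDescentsBefore (d ∸ 1) c t x i →
                ∀ p q → i <ᶠ p → p <ᶠ q → lookup x p <[ t ] lookup x q

module Submission where

-- Deleting admissible elements from C only ever produces divisions of one of four forms
-- (shapeDivision).  The main one consists of the remaining elements below θ₁ = n - m (that is,
-- of C₁), a empty blocks, the remaining elements in [θ₁, θ₂), those ≥ θ₂, and b empty blocks,
-- where θ₂ is the last deleted element outside C₁ (initially λ); the other forms arise once the
-- first two or the last two of these blocks have merged.  Whether an element is admissible depends
-- only on how it compares with θ₁, θ₂ and the remaining elements, so the C-permutations are the
-- words accepted by an automaton on these forms (Run).  Its steps match the conditions one by one:
-- an element of C₁ must be the least remaining one, which is (a), and is itself a C₁-descent; an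
-- element below θ₂ makes the preceding element outside C₁ a C₁-descent; each of these uses up one
-- of the a = k - 3 gaps or merges the first two blocks, whereas an element above θ₂ only uses up a
-- gap on the right.  So the (k-1)-th C₁-descent leaves a single block, from which only the
-- minimum can be taken next, which is (c).

open import Defs
open import Data.Nat using (ℕ; zero; suc; _+_; _∸_; _≤_; _<_; z≤n; s≤s; z<s; s<s⁻¹; _<?_; _≤?_)
open import Data.Nat.Properties
open import Data.Fin using (Fin; punchIn; punchOut) renaming (_<_ to _<ᶠ_)
import Data.Fin as Fin
open import Data.Fin.Properties using (¬Fin0; any?; punchIn-injective; punchInᵢ≢i; punchIn-punchOut) renaming (suc-injective to fsuc-injective)
open import Data.List using (List; []; _∷_; _++_; map; upTo; replicate; filter; length)
open import Data.List.Properties using (length-map; length-replicate; ++-identityʳ)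
open import Data.List.Membership.Propositional using (_∈_; _∉_)
open import Data.List.Membership.Propositional.Properties using (∈-filter⁺; ∈-filter⁻; ∈-++⁺ˡ; ∈-++⁺ʳ; ∈-++⁻; ∈-map⁺; ∈-map⁻; ∈-upTo⁺; ∈-upTo⁻)
open import Data.List.Relation.Unary.Any using (Any; here; there)
import Data.List.Relation.Unary.Any as Any
open import Data.List.Relation.Unary.All using (All; []; _∷_)
import Data.List.Relation.Unary.All as All
import Data.List.Relation.Unary.All.Properties as AllP
open import Data.List.Relation.Unary.AllPairs using (AllPairs; []; _∷_)
import Data.List.Relation.Unary.AllPairs.Properties as AP
open import Data.List.Relation.Unary.Unique.Propositional.Properties using (upTo⁺)
open import Data.List.Relation.Binary.Permutation.Propositional using (_↭_; ↭-sym; ↭⇒↭ₛ)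
open import Data.List.Relation.Binary.Permutation.Propositional.Properties using (∈-resp-↭)
import Data.List.Relation.Binary.Permutation.Setoid.Properties as PSP
open import Data.Vec using (Vec; []; _∷_; lookup; toList)
open import Data.Vec.Properties using (toList-map; length-toList)
open import Data.Maybe using (just; nothing)
open import Data.Product using (Σ; _×_; _,_; proj₁; proj₂; ∃)
open import Data.Sum using (_⊎_; inj₁; inj₂; [_,_])
open import Data.Empty using (⊥; ⊥-elim)
open import Data.Unit using (⊤; tt)
open import Function.Bundles using (_⇔_; mk⇔; module Equivalence)
open Equivalence using (to; from)
import Function.Properties.Equivalence as ⇔
open import Level using (0ℓ)
import Relation.Binary.Reasoning.Setoid as SetoidReasoning
open import Relation.Nullary using (¬_; yes; no; Dec)
open import Relation.Unary using (Decidable)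
open import Relation.Binary.PropositionalEquality using (_≡_; _≢_; ≢-sym; refl; sym; trans; cong; subst; setoid)


_≋_ : List ℕ → List ℕ → Set
B ≋ B' = ∀ x → (x ∈ B → x ∈ B') × (x ∈ B' → x ∈ B)

mk≋ : ∀ {A B} → (∀ x → x ∈ A → x ∈ B) → (∀ x → x ∈ B → x ∈ A) → A ≋ B
mk≋ f g x = f x , g x

≋-refl : ∀ {B} → B ≋ B
≋-refl x = (λ p → p) , (λ p → p)

≋-sym : ∀ {A B} → A ≋ B → B ≋ A
≋-sym e x = proj₂ (e x) , proj₁ (e x)

infixr 5 _∷≈_
data _≈D_ : Division → Division → Set where
  []≈  : [] ≈D []
  _∷≈_ : ∀ {B B' D D'} → B ≋ B' → D ≈D D' → (B ∷ D) ≈D (B' ∷ D')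

≈D-refl : ∀ {D} → D ≈D D
≈D-refl {[]} = []≈
≈D-refl {B ∷ D} = ≋-refl ∷≈ ≈D-refl

≈D-sym : ∀ {D D'} → D ≈D D' → D' ≈D D
≈D-sym []≈ = []≈
≈D-sym (b ∷≈ e) = ≋-sym b ∷≈ ≈D-sym e

≈D-length : ∀ {D D'} → D ≈D D' → length D ≡ length D'
≈D-length []≈ = refl
≈D-length (_ ∷≈ e) = cong suc (≈D-length e)

≈D-block : ∀ {D D'} → D ≈D D' → ∀ i → block D i ≋ block D' i
≈D-block []≈ i = ≋-refl
≈D-block (b ∷≈ e) zero = b
≈D-block (b ∷≈ e) (suc i) = ≈D-block e i

Adm-resp-≈D : ∀ {D D' s i} → D ≈D D' → Adm D s i → Adm D' s i
Adm-resp-≈D e (first m f) =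
  first (proj₁ (≈D-block e 0 _) m) (λ t t∈ → f t (proj₂ (≈D-block e 0 t) t∈))
Adm-resp-≈D {i = i} e (last l m f) =
  last (trans l (≈D-length e)) (proj₁ (≈D-block e i _) m) (λ t t∈ → f t (proj₂ (≈D-block e i t) t∈))
Adm-resp-≈D {i = i} e (mid p l m) =
  mid p (subst (suc i <_) (≈D-length e) l) (proj₁ (≈D-block e i _) m)

filter-resp-≋ : ∀ {P : ℕ → Set} (P? : Decidable P) {B B'} → B ≋ B' → filter P? B ≋ filter P? B'
filter-resp-≋ P? b x =
  (λ p → let (q , px) = ∈-filter⁻ P? p in ∈-filter⁺ P? (proj₁ (b x) q) px) ,
  (λ p → let (q , px) = ∈-filter⁻ P? p in ∈-filter⁺ P? (proj₂ (b x) q) px)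

++-resp-≋ : ∀ {A A' B B'} → A ≋ A' → B ≋ B' → (A ++ B) ≋ (A' ++ B')
++-resp-≋ {A} {A'} a b x =
  (λ p → [ (λ q → ∈-++⁺ˡ (proj₁ (a x) q)) , (λ q → ∈-++⁺ʳ A' (proj₁ (b x) q)) ] (∈-++⁻ A p)) ,
  (λ p → [ (λ q → ∈-++⁺ˡ (proj₂ (a x) q)) , (λ q → ∈-++⁺ʳ A (proj₂ (b x) q)) ] (∈-++⁻ A' p))

++[]-resp-≋ : ∀ {A B} → A ≋ B → (A ++ []) ≋ B
++[]-resp-≋ {A} e rewrite ++-identityʳ A = e

delAt-resp-≈D : ∀ {P P' D D'} j s → P ≋ P' → D ≈D D' → delAt P D j s ≈D delAt P' D' j s
delAt-resp-≈D j s p []≈ = p ∷≈ []≈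
delAt-resp-≈D zero s p (b ∷≈ []≈) = ++-resp-≋ p (filter-resp-≋ (_<? s) b) ∷≈ []≈
delAt-resp-≈D zero s p (b ∷≈ b' ∷≈ e) = ++-resp-≋ p (filter-resp-≋ (_<? s) b)
    ∷≈ ++-resp-≋ (filter-resp-≋ (s <?_) b) b' ∷≈ e
delAt-resp-≈D (suc j) s p (b ∷≈ []≈) = p ∷≈ delAt-resp-≈D j s b []≈
delAt-resp-≈D (suc j) s p (b ∷≈ b' ∷≈ e) = p ∷≈ delAt-resp-≈D j s b (b' ∷≈ e)

del-resp-≈D : ∀ {D D'} i s → D ≈D D' → del D i s ≈D del D' i s
del-resp-≈D i s []≈ = []≈
del-resp-≈D zero s (b ∷≈ []≈) = filter-resp-≋ (s <?_) b ∷≈ []≈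
del-resp-≈D zero s (b ∷≈ b' ∷≈ e) = ++-resp-≋ (filter-resp-≋ (s <?_) b) b' ∷≈ e
del-resp-≈D (suc i) s (b ∷≈ []≈) = delAt-resp-≈D i s b []≈
del-resp-≈D (suc i) s (b ∷≈ b' ∷≈ e) = delAt-resp-≈D i s b (b' ∷≈ e)

IsCPerm-resp-≈D : ∀ {D D' w} → D ≈D D' → IsCPerm D w → IsCPerm D' w
IsCPerm-resp-≈D e [] = []
IsCPerm-resp-≈D {w = s ∷ w} e (_∷_ {i = i} a r) = Adm-resp-≈D e a ∷ IsCPerm-resp-≈D (del-resp-≈D i s e) r

IsCPerm-cong : ∀ {D D' w} → D ≈D D' → IsCPerm D w ⇔ IsCPerm D' w
IsCPerm-cong e = mk⇔ (IsCPerm-resp-≈D e) (IsCPerm-resp-≈D (≈D-sym e))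


-- Shapes of the divisions reached from C

atLeast : ℕ → List ℕ → List ℕ
atLeast θ w = filter (θ ≤?_) w

below⁻ : ∀ θ w {x} → x ∈ below θ w → x ∈ w × x < θ
below⁻ θ w = ∈-filter⁻ (_<? θ)
below⁺ : ∀ θ w {x} → x ∈ w → x < θ → x ∈ below θ w
below⁺ θ w = ∈-filter⁺ (_<? θ)
above⁻ : ∀ θ w {x} → x ∈ above θ w → x ∈ w × θ < x
above⁻ θ w = ∈-filter⁻ (θ <?_)
above⁺ : ∀ θ w {x} → x ∈ w → θ < x → x ∈ above θ w
above⁺ θ w = ∈-filter⁺ (θ <?_)
atLeast⁻ : ∀ θ w {x} → x ∈ atLeast θ w → x ∈ w × θ ≤ x
atLeast⁻ θ w = ∈-filter⁻ (θ ≤?_)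
atLeast⁺ : ∀ θ w {x} → x ∈ w → θ ≤ x → x ∈ atLeast θ w
atLeast⁺ θ w = ∈-filter⁺ (θ ≤?_)

∉⇒≢ : ∀ {s x : ℕ} {w} → s ∉ w → x ∈ w → x ≢ s
∉⇒≢ nd m refl = nd m

∈-∷-≢ : ∀ {x s : ℕ} {w} → x ∈ s ∷ w → x ≢ s → x ∈ w
∈-∷-≢ (here e) ne = ⊥-elim (ne e)
∈-∷-≢ (there m) ne = m

Adm⇒∈-block : ∀ {D s i} → Adm D s i → s ∈ block D i
Adm⇒∈-block (first m _) = m
Adm⇒∈-block (last _ m _) = m
Adm⇒∈-block (mid _ _ m) = m

gaps : ℕ → Division
gaps b = replicate b []

gaps-++-resp-≈D : ∀ a {X Y} → X ≈D Y → (gaps a ++ X) ≈D (gaps a ++ Y)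
gaps-++-resp-≈D zero e = e
gaps-++-resp-≈D (suc a) e = ≋-refl ∷≈ gaps-++-resp-≈D a e

gaps-++-[]∷ : ∀ a X → gaps a ++ ([] ∷ X) ≡ [] ∷ (gaps a ++ X)
gaps-++-[]∷ zero X = refl
gaps-++-[]∷ (suc a) X = cong ([] ∷_) (gaps-++-[]∷ a X)

length-gaps-++ : ∀ a X → length (gaps a ++ X) ≡ a + length X
length-gaps-++ zero X = refl
length-gaps-++ (suc a) X = cong suc (length-gaps-++ a X)

block-gaps-++⁻ : ∀ a Ds i {x} → x ∈ block (gaps a ++ Ds) i → Σ ℕ (λ j → i ≡ a + j × x ∈ block Ds j)
block-gaps-++⁻ zero Ds i m = i , refl , m
block-gaps-++⁻ (suc a) Ds zero ()
block-gaps-++⁻ (suc a) Ds (suc i) m with block-gaps-++⁻ a Ds i m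
... | j , e , m' = j , cong suc e , m'

∉-block-gaps : ∀ b i {x} → x ∈ block (gaps b) i → ⊥
∉-block-gaps zero i ()
∉-block-gaps (suc b) zero ()
∉-block-gaps (suc b) (suc i) m = ∉-block-gaps b i m

block-gaps-++ : ∀ a Ds j → block (gaps a ++ Ds) (a + j) ≡ block Ds j
block-gaps-++ zero Ds j = refl
block-gaps-++ (suc a) Ds j = block-gaps-++ a Ds j

delAt-gaps-++ : ∀ a B Ds j s → delAt [] (gaps a ++ B ∷ Ds) (a + j) s ≡ gaps a ++ delAt [] (B ∷ Ds) j s
delAt-gaps-++ zero B Ds j s = refl
delAt-gaps-++ (suc zero) B Ds j s = refl
delAt-gaps-++ (suc (suc a)) B Ds j s = cong ([] ∷_) (delAt-gaps-++ (suc a) B Ds j s)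

delAt-[]∷-gaps-++ : ∀ P a B Ds j s → delAt P ([] ∷ (gaps a ++ B ∷ Ds)) (suc (a + j)) s
  ≡ P ∷ (gaps a ++ delAt [] (B ∷ Ds) j s)
delAt-[]∷-gaps-++ P zero B Ds j s = refl
delAt-[]∷-gaps-++ P (suc a) B Ds j s = cong (P ∷_) (delAt-gaps-++ (suc a) B Ds j s)

data Shape : Set where
  three : ℕ → ℕ → ℕ → ℕ → Shape
  apart : ℕ → ℕ → Shape
  adjacent : ℕ → ℕ → Shape
  one : ℕ → Shape

shapeDivision : Shape → List ℕ → Division
shapeDivision (three θ1 θ2 a b) w = below θ1 w ∷ (gaps a ++ (below θ2 (atLeast θ1 w) ∷ atLeast θ2 w ∷ gaps b))
shapeDivision (apart θ a) w = below θ w ∷ (gaps a ++ (atLeast θ w ∷ []))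
shapeDivision (adjacent θ b) w = below θ w ∷ atLeast θ w ∷ gaps b
shapeDivision (one b) w = w ∷ gaps b

Ordered : Shape → Set
Ordered (three θ1 θ2 a b) = θ1 ≤ θ2
Ordered _ = ⊤

Distinct : List ℕ → Set
Distinct [] = ⊤
Distinct (s ∷ w) = s ∉ w × Distinct w

LowerBoundBelow : ℕ → ℕ → List ℕ → Set
LowerBoundBelow θ s w = ∀ x → x ∈ w → x < θ → s ≤ x

UpperBoundFrom : ℕ → ℕ → List ℕ → Set
UpperBoundFrom θ s w = ∀ x → x ∈ w → θ ≤ x → x ≤ s

LowerBound : ℕ → List ℕ → Set
LowerBound s w = ∀ x → x ∈ w → s ≤ x

-- Run σ w: the elements of w can be deleted in this order from shapeDivision σ w.  Each
-- constructor deletes from the block it is named after (low: the first block; mid, high: the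
-- two blocks after the a gaps; min: the single block) under the condition that makes the element
-- admissible, and continues from the shape that the deletion produces.  The ₀ variants apply
-- when the gap counter that the step uses up is already zero.
data Run : Shape → List ℕ → Set where
  done : ∀ {σ} → Run σ []
  three-low : ∀ {θ1 θ2 a b s w} → s < θ1 → LowerBoundBelow θ1 s w →
    Run (three θ1 θ2 a b) w → Run (three θ1 θ2 (suc a) b) (s ∷ w)
  three-low₀ : ∀ {θ1 θ2 b s w} → s < θ1 → LowerBoundBelow θ1 s w →
    Run (adjacent θ2 b) w → Run (three θ1 θ2 0 b) (s ∷ w)
  three-mid : ∀ {θ1 θ2 a b s w} → θ1 ≤ s → s < θ2 →
    Run (three θ1 s a b) w → Run (three θ1 θ2 (suc a) b) (s ∷ w)
  three-mid₀ : ∀ {θ1 θ2 b s w} → θ1 ≤ s → s < θ2 →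
    Run (adjacent s b) w → Run (three θ1 θ2 0 b) (s ∷ w)
  three-high : ∀ {θ1 θ2 a b s w} → θ2 ≤ s →
    Run (three θ1 s a b) w → Run (three θ1 θ2 a (suc b)) (s ∷ w)
  three-high₀ : ∀ {θ1 θ2 a s w} → θ2 ≤ s → UpperBoundFrom θ2 s w →
    Run (apart θ1 a) w → Run (three θ1 θ2 a 0) (s ∷ w)
  apart-low : ∀ {θ a s w} → s < θ → LowerBoundBelow θ s w →
    Run (apart θ a) w → Run (apart θ (suc a)) (s ∷ w)
  apart-low₀ : ∀ {θ s w} → s < θ → LowerBoundBelow θ s w →
    Run (one 0) w → Run (apart θ 0) (s ∷ w)
  apart-high : ∀ {θ a s w} → θ ≤ s → UpperBoundFrom θ s w →
    Run (apart θ a) w → Run (apart θ (suc a)) (s ∷ w)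
  apart-high₀ : ∀ {θ s w} → θ ≤ s → UpperBoundFrom θ s w →
    Run (one 0) w → Run (apart θ 0) (s ∷ w)
  adjacent-low : ∀ {θ b s w} → s < θ → LowerBoundBelow θ s w →
    Run (one b) w → Run (adjacent θ b) (s ∷ w)
  adjacent-high : ∀ {θ b s w} → θ ≤ s →
    Run (adjacent s b) w → Run (adjacent θ (suc b)) (s ∷ w)
  adjacent-high₀ : ∀ {θ s w} → θ ≤ s → UpperBoundFrom θ s w →
    Run (one 0) w → Run (adjacent θ 0) (s ∷ w)
  one-min : ∀ {b s w} → LowerBound s w → Run (one b) w → Run (one (suc b)) (s ∷ w)
  one-min₀ : ∀ {s w} → LowerBound s w → Run (one 0) w → Run (one 0) (s ∷ w)


filter-∷-reject : ∀ {P : ℕ → Set} (P? : Decidable P) {s w} → ¬ P s → filter P? (s ∷ w) ≋ filter P? w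
filter-∷-reject P? {s} {w} ¬Ps = mk≋ f g
  where
  f : ∀ x → x ∈ filter P? (s ∷ w) → x ∈ filter P? w
  f x p = let (m , px) = ∈-filter⁻ P? p in
    ∈-filter⁺ P? (∈-∷-≢ m (λ { refl → ¬Ps px })) px
  g : ∀ x → x ∈ filter P? w → x ∈ filter P? (s ∷ w)
  g x p = let (m , px) = ∈-filter⁻ P? p in ∈-filter⁺ P? (there m) px

below-∷-≥ : ∀ {θ s w} → θ ≤ s → below θ (s ∷ w) ≋ below θ w
below-∷-≥ {θ} le = filter-∷-reject (_<? θ) (≤⇒≯ le)

atLeast-∷-< : ∀ {θ s w} → s < θ → atLeast θ (s ∷ w) ≋ atLeast θ w
atLeast-∷-< {θ} lt = filter-∷-reject (θ ≤?_) (<⇒≱ lt)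

above-min-below : ∀ {θ s w} → s < θ → LowerBoundBelow θ s w → s ∉ w → above s (below θ (s ∷ w)) ≋ below θ w
above-min-below {θ} {s} {w} s<θ lo nd = mk≋ f g
  where
  f : ∀ x → x ∈ above s (below θ (s ∷ w)) → x ∈ below θ w
  f x p = let (q , s<x) = above⁻ s _ p ; (m , x<θ) = below⁻ θ (s ∷ w) q in below⁺ θ w (∈-∷-≢ m (>⇒≢ s<x)) x<θ
  g : ∀ x → x ∈ below θ w → x ∈ above s (below θ (s ∷ w))
  g x p = let (m , x<θ) = below⁻ θ w p in
    above⁺ s _ (below⁺ θ (s ∷ w) (there m) x<θ) (≤∧≢⇒< (lo x m x<θ) (≢-sym (∉⇒≢ nd m)))

above-min-below-++-mid : ∀ {θ1 θ2 s w} → s < θ1 → θ1 ≤ θ2 → LowerBoundBelow θ1 s w → s ∉ w →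
  (above s (below θ1 (s ∷ w)) ++ below θ2 (atLeast θ1 (s ∷ w))) ≋ below θ2 w
above-min-below-++-mid {θ1} {θ2} {s} {w} s<θ1 le lo nd = mk≋ f g
  where
  f : ∀ x → x ∈ (above s (below θ1 (s ∷ w)) ++ below θ2 (atLeast θ1 (s ∷ w))) → x ∈ below θ2 w
  f x p with ∈-++⁻ (above s (below θ1 (s ∷ w))) p
  ... | inj₁ q = let (m , x<θ1) = below⁻ θ1 w (proj₁ (above-min-below s<θ1 lo nd x) q) in below⁺ θ2 w m (<-≤-trans x<θ1 le)
  ... | inj₂ q = let (q' , x<θ2) = below⁻ θ2 _ q ; (m , θ1≤x) = atLeast⁻ θ1 (s ∷ w) q' in
    below⁺ θ2 w (∈-∷-≢ m (>⇒≢ (<-≤-trans s<θ1 θ1≤x))) x<θ2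
  g : ∀ x → x ∈ below θ2 w → x ∈ (above s (below θ1 (s ∷ w)) ++ below θ2 (atLeast θ1 (s ∷ w)))
  g x p with below⁻ θ2 w p | x <? θ1
  ... | m , x<θ2 | yes x<θ1 = ∈-++⁺ˡ (proj₂ (above-min-below s<θ1 lo nd x) (below⁺ θ1 w m x<θ1))
  ... | m , x<θ2 | no ¬x<θ1 = ∈-++⁺ʳ (above s (below θ1 (s ∷ w)))
      (below⁺ θ2 _ (atLeast⁺ θ1 (s ∷ w) (there m) (≮⇒≥ ¬x<θ1)) x<θ2)

below-mid-∷ : ∀ {θ1 θ2 s w} → θ1 ≤ s → s < θ2 → s ∉ w →
  below s (below θ2 (atLeast θ1 (s ∷ w))) ≋ below s (atLeast θ1 w)
below-mid-∷ {θ1} {θ2} {s} {w} le lt nd = mk≋ f g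
  where
  f : ∀ x → x ∈ below s (below θ2 (atLeast θ1 (s ∷ w))) → x ∈ below s (atLeast θ1 w)
  f x p = let (q , x<s) = below⁻ s _ p ; (q' , _) = below⁻ θ2 _ q ; (m , θ1≤x) = atLeast⁻ θ1 (s ∷ w) q' in
    below⁺ s _ (atLeast⁺ θ1 w (∈-∷-≢ m (<⇒≢ x<s)) θ1≤x) x<s
  g : ∀ x → x ∈ below s (atLeast θ1 w) → x ∈ below s (below θ2 (atLeast θ1 (s ∷ w)))
  g x p = let (q , x<s) = below⁻ s _ p ; (m , θ1≤x) = atLeast⁻ θ1 w q in
    below⁺ s _ (below⁺ θ2 _ (atLeast⁺ θ1 (s ∷ w) (there m) θ1≤x) (<-trans x<s lt)) x<s

above-mid-++-high : ∀ {θ1 θ2 s w} → θ1 ≤ s → s < θ2 → s ∉ w →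
  (above s (below θ2 (atLeast θ1 (s ∷ w))) ++ atLeast θ2 (s ∷ w)) ≋ atLeast s w
above-mid-++-high {θ1} {θ2} {s} {w} le lt nd = mk≋ f g
  where
  f : ∀ x → x ∈ (above s (below θ2 (atLeast θ1 (s ∷ w))) ++ atLeast θ2 (s ∷ w)) → x ∈ atLeast s w
  f x p with ∈-++⁻ (above s (below θ2 (atLeast θ1 (s ∷ w)))) p
  ... | inj₁ q = let (q1 , s<x) = above⁻ s _ q ; (q2 , _) = below⁻ θ2 _ q1 ; (m , _) = atLeast⁻ θ1 (s ∷ w) q2 in
    atLeast⁺ s w (∈-∷-≢ m (>⇒≢ s<x)) (<⇒≤ s<x)
  ... | inj₂ q = let (m , θ2≤x) = atLeast⁻ θ2 (s ∷ w) q in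
    atLeast⁺ s w (∈-∷-≢ m (>⇒≢ (<-≤-trans lt θ2≤x))) (<⇒≤ (<-≤-trans lt θ2≤x))
  g : ∀ x → x ∈ atLeast s w → x ∈ (above s (below θ2 (atLeast θ1 (s ∷ w))) ++ atLeast θ2 (s ∷ w))
  g x p with atLeast⁻ s w p | x <? θ2
  ... | m , s≤x | yes x<θ2 =
    let s<x = ≤∧≢⇒< s≤x (≢-sym (∉⇒≢ nd m)) in
    ∈-++⁺ˡ (above⁺ s _ (below⁺ θ2 _ (atLeast⁺ θ1 (s ∷ w) (there m) (≤-trans le s≤x)) x<θ2) s<x)
  ... | m , s≤x | no ¬x<θ2 = ∈-++⁺ʳ (above s (below θ2 (atLeast θ1 (s ∷ w))))
      (atLeast⁺ θ2 (s ∷ w) (there m) (≮⇒≥ ¬x<θ2))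

low-++-below-mid : ∀ {θ1 θ2 s w} → θ1 ≤ s → s < θ2 → s ∉ w →
  (below θ1 (s ∷ w) ++ below s (below θ2 (atLeast θ1 (s ∷ w)))) ≋ below s w
low-++-below-mid {θ1} {θ2} {s} {w} le lt nd = mk≋ f g
  where
  f : ∀ x → x ∈ (below θ1 (s ∷ w) ++ below s (below θ2 (atLeast θ1 (s ∷ w)))) → x ∈ below s w
  f x p with ∈-++⁻ (below θ1 (s ∷ w)) p
  ... | inj₁ q = let (m , x<θ1) = below⁻ θ1 (s ∷ w) q ; x<s = <-≤-trans x<θ1 le in below⁺ s w (∈-∷-≢ m (<⇒≢ x<s)) x<s
  ... | inj₂ q = let (q1 , x<s) = below⁻ s _ q ; (q2 , _) = below⁻ θ2 _ q1 ; (m , _) = atLeast⁻ θ1 (s ∷ w) q2 in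
    below⁺ s w (∈-∷-≢ m (<⇒≢ x<s)) x<s
  g : ∀ x → x ∈ below s w → x ∈ (below θ1 (s ∷ w) ++ below s (below θ2 (atLeast θ1 (s ∷ w))))
  g x p with below⁻ s w p | x <? θ1
  ... | m , x<s | yes x<θ1 = ∈-++⁺ˡ (below⁺ θ1 (s ∷ w) (there m) x<θ1)
  ... | m , x<s | no ¬x<θ1 = ∈-++⁺ʳ (below θ1 (s ∷ w))
      (below⁺ s _ (below⁺ θ2 _ (atLeast⁺ θ1 (s ∷ w) (there m) (≮⇒≥ ¬x<θ1)) (<-trans x<s lt)) x<s)

mid-++-below-high : ∀ {θ1 θ2 s w} → θ1 ≤ θ2 → θ2 ≤ s → s ∉ w →
  (below θ2 (atLeast θ1 (s ∷ w)) ++ below s (atLeast θ2 (s ∷ w))) ≋ below s (atLeast θ1 w)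
mid-++-below-high {θ1} {θ2} {s} {w} le12 le nd = mk≋ f g
  where
  f : ∀ x → x ∈ (below θ2 (atLeast θ1 (s ∷ w)) ++ below s (atLeast θ2 (s ∷ w))) → x ∈ below s (atLeast θ1 w)
  f x p with ∈-++⁻ (below θ2 (atLeast θ1 (s ∷ w))) p
  ... | inj₁ q = let (q1 , x<θ2) = below⁻ θ2 _ q ; (m , θ1≤x) = atLeast⁻ θ1 (s ∷ w) q1 ; x<s = <-≤-trans x<θ2 le in
    below⁺ s _ (atLeast⁺ θ1 w (∈-∷-≢ m (<⇒≢ x<s)) θ1≤x) x<s
  ... | inj₂ q = let (q1 , x<s) = below⁻ s _ q ; (m , θ2≤x) = atLeast⁻ θ2 (s ∷ w) q1 in
    below⁺ s _ (atLeast⁺ θ1 w (∈-∷-≢ m (<⇒≢ x<s)) (≤-trans le12 θ2≤x)) x<s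
  g : ∀ x → x ∈ below s (atLeast θ1 w) → x ∈ (below θ2 (atLeast θ1 (s ∷ w)) ++ below s (atLeast θ2 (s ∷ w)))
  g x p with below⁻ s _ p | x <? θ2
  ... | q , x<s | yes x<θ2 = let (m , θ1≤x) = atLeast⁻ θ1 w q in
      ∈-++⁺ˡ (below⁺ θ2 _ (atLeast⁺ θ1 (s ∷ w) (there m) θ1≤x) x<θ2)
  ... | q , x<s | no ¬x<θ2 = let (m , θ1≤x) = atLeast⁻ θ1 w q in
    ∈-++⁺ʳ (below θ2 (atLeast θ1 (s ∷ w))) (below⁺ s _ (atLeast⁺ θ2 (s ∷ w) (there m) (≮⇒≥ ¬x<θ2)) x<s)

above-atLeast-∷ : ∀ {θ s w} → θ ≤ s → s ∉ w → (above s (atLeast θ (s ∷ w)) ++ []) ≋ atLeast s w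
above-atLeast-∷ {θ} {s} {w} le nd = ++[]-resp-≋ (mk≋ f g)
  where
  f : ∀ x → x ∈ above s (atLeast θ (s ∷ w)) → x ∈ atLeast s w
  f x p = let (q , s<x) = above⁻ s _ p ; (m , _) = atLeast⁻ θ (s ∷ w) q in atLeast⁺ s w (∈-∷-≢ m (>⇒≢ s<x)) (<⇒≤ s<x)
  g : ∀ x → x ∈ atLeast s w → x ∈ above s (atLeast θ (s ∷ w))
  g x p = let (m , s≤x) = atLeast⁻ s w p ; s<x = ≤∧≢⇒< s≤x (≢-sym (∉⇒≢ nd m)) in
    above⁺ s _ (atLeast⁺ θ (s ∷ w) (there m) (≤-trans le s≤x)) s<x

mid-++-below-max : ∀ {θ1 θ2 s w} → θ1 ≤ θ2 → θ2 ≤ s → UpperBoundFrom θ2 s w → s ∉ w →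
  (below θ2 (atLeast θ1 (s ∷ w)) ++ below s (atLeast θ2 (s ∷ w))) ≋ atLeast θ1 w
mid-++-below-max {θ1} {θ2} {s} {w} le12 le hi nd = mk≋ f g
  where
  f : ∀ x → x ∈ (below θ2 (atLeast θ1 (s ∷ w)) ++ below s (atLeast θ2 (s ∷ w))) → x ∈ atLeast θ1 w
  f x p = proj₁ (below⁻ s _ (proj₁ (mid-++-below-high le12 le nd x) p))
  g : ∀ x → x ∈ atLeast θ1 w → x ∈ (below θ2 (atLeast θ1 (s ∷ w)) ++ below s (atLeast θ2 (s ∷ w)))
  g x p with atLeast⁻ θ1 w p | x <? θ2
  ... | m , θ1≤x | yes x<θ2 = ∈-++⁺ˡ (below⁺ θ2 _ (atLeast⁺ θ1 (s ∷ w) (there m) θ1≤x) x<θ2)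
  ... | m , θ1≤x | no ¬x<θ2 =
    let θ2≤x = ≮⇒≥ ¬x<θ2 ; x<s = ≤∧≢⇒< (hi x m θ2≤x) (∉⇒≢ nd m) in
    ∈-++⁺ʳ (below θ2 (atLeast θ1 (s ∷ w))) (below⁺ s _ (atLeast⁺ θ2 (s ∷ w) (there m) θ2≤x) x<s)

above-min-++-atLeast : ∀ {θ s w} → s < θ → LowerBoundBelow θ s w → s ∉ w →
  (above s (below θ (s ∷ w)) ++ atLeast θ (s ∷ w)) ≋ w
above-min-++-atLeast {θ} {s} {w} s<θ lo nd = mk≋ f g
  where
  f : ∀ x → x ∈ (above s (below θ (s ∷ w)) ++ atLeast θ (s ∷ w)) → x ∈ w
  f x p with ∈-++⁻ (above s (below θ (s ∷ w))) p
  ... | inj₁ q = proj₁ (below⁻ θ w (proj₁ (above-min-below s<θ lo nd x) q))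
  ... | inj₂ q = proj₁ (atLeast⁻ θ w (proj₁ (atLeast-∷-< s<θ x) q))
  g : ∀ x → x ∈ w → x ∈ (above s (below θ (s ∷ w)) ++ atLeast θ (s ∷ w))
  g x m with x <? θ
  ... | yes x<θ = ∈-++⁺ˡ (proj₂ (above-min-below s<θ lo nd x) (below⁺ θ w m x<θ))
  ... | no ¬x<θ = ∈-++⁺ʳ (above s (below θ (s ∷ w))) (atLeast⁺ θ (s ∷ w) (there m) (≮⇒≥ ¬x<θ))

below-max-atLeast : ∀ {θ s w} → θ ≤ s → UpperBoundFrom θ s w → s ∉ w → below s (atLeast θ (s ∷ w)) ≋ atLeast θ w
below-max-atLeast {θ} {s} {w} le hi nd = mk≋ f g
  where
  f : ∀ x → x ∈ below s (atLeast θ (s ∷ w)) → x ∈ atLeast θ w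
  f x p = let (q , x<s) = below⁻ s _ p ; (m , θ≤x) = atLeast⁻ θ (s ∷ w) q in atLeast⁺ θ w (∈-∷-≢ m (<⇒≢ x<s)) θ≤x
  g : ∀ x → x ∈ atLeast θ w → x ∈ below s (atLeast θ (s ∷ w))
  g x p = let (m , θ≤x) = atLeast⁻ θ w p in
      below⁺ s _ (atLeast⁺ θ (s ∷ w) (there m) θ≤x) (≤∧≢⇒< (hi x m θ≤x) (∉⇒≢ nd m))

low-++-below-atLeast : ∀ {θ s w} → θ ≤ s → s ∉ w → (below θ (s ∷ w) ++ below s (atLeast θ (s ∷ w))) ≋ below s w
low-++-below-atLeast {θ} {s} {w} le nd = mk≋ f g
  where
  f : ∀ x → x ∈ (below θ (s ∷ w) ++ below s (atLeast θ (s ∷ w))) → x ∈ below s w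
  f x p with ∈-++⁻ (below θ (s ∷ w)) p
  ... | inj₁ q = let (m , x<θ) = below⁻ θ (s ∷ w) q ; x<s = <-≤-trans x<θ le in below⁺ s w (∈-∷-≢ m (<⇒≢ x<s)) x<s
  ... | inj₂ q = let (q1 , x<s) = below⁻ s _ q ; (m , _) = atLeast⁻ θ (s ∷ w) q1 in below⁺ s w (∈-∷-≢ m (<⇒≢ x<s)) x<s
  g : ∀ x → x ∈ below s w → x ∈ (below θ (s ∷ w) ++ below s (atLeast θ (s ∷ w)))
  g x p with below⁻ s w p | x <? θ
  ... | m , x<s | yes x<θ = ∈-++⁺ˡ (below⁺ θ (s ∷ w) (there m) x<θ)
  ... | m , x<s | no ¬x<θ = ∈-++⁺ʳ (below θ (s ∷ w)) (below⁺ s _ (atLeast⁺ θ (s ∷ w) (there m) (≮⇒≥ ¬x<θ)) x<s)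

low-++-below-max : ∀ {θ s w} → θ ≤ s → UpperBoundFrom θ s w → s ∉ w →
  (below θ (s ∷ w) ++ below s (atLeast θ (s ∷ w))) ≋ w
low-++-below-max {θ} {s} {w} le hi nd = mk≋ f g
  where
  f : ∀ x → x ∈ (below θ (s ∷ w) ++ below s (atLeast θ (s ∷ w))) → x ∈ w
  f x p = proj₁ (below⁻ s w (proj₁ (low-++-below-atLeast le nd x) p))
  g : ∀ x → x ∈ w → x ∈ (below θ (s ∷ w) ++ below s (atLeast θ (s ∷ w)))
  g x m with x <? θ
  ... | yes x<θ = ∈-++⁺ˡ (below⁺ θ (s ∷ w) (there m) x<θ)
  ... | no ¬x<θ = ∈-++⁺ʳ (below θ (s ∷ w)) (proj₂ (below-max-atLeast le hi nd x) (atLeast⁺ θ w m (≮⇒≥ ¬x<θ)))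

above-min-∷ : ∀ {s w} → LowerBound s w → s ∉ w → above s (s ∷ w) ≋ w
above-min-∷ {s} {w} lo nd = mk≋ f g
  where
  f : ∀ x → x ∈ above s (s ∷ w) → x ∈ w
  f x p = let (m , s<x) = above⁻ s (s ∷ w) p in ∈-∷-≢ m (>⇒≢ s<x)
  g : ∀ x → x ∈ w → x ∈ above s (s ∷ w)
  g x m = above⁺ s (s ∷ w) (there m) (≤∧≢⇒< (lo x m) (≢-sym (∉⇒≢ nd m)))

del-three-low : ∀ {θ1 θ2 a b s w} → s < θ1 → θ1 ≤ θ2 → LowerBoundBelow θ1 s w → s ∉ w →
  del (shapeDivision (three θ1 θ2 (suc a) b) (s ∷ w)) 0 s ≈D shapeDivision (three θ1 θ2 a b) w
del-three-low {θ2 = θ2} {a} s<θ1 le lo nd =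
  ++[]-resp-≋ (above-min-below s<θ1 lo nd) ∷≈
    gaps-++-resp-≈D a (filter-resp-≋ (_<? θ2) (atLeast-∷-< s<θ1) ∷≈ atLeast-∷-< (<-≤-trans s<θ1 le) ∷≈ ≈D-refl)

del-three-low₀ : ∀ {θ1 θ2 b s w} → s < θ1 → θ1 ≤ θ2 → LowerBoundBelow θ1 s w → s ∉ w →
  del (shapeDivision (three θ1 θ2 0 b) (s ∷ w)) 0 s ≈D shapeDivision (adjacent θ2 b) w
del-three-low₀ s<θ1 le lo nd = above-min-below-++-mid s<θ1 le lo nd ∷≈ atLeast-∷-< (<-≤-trans s<θ1 le) ∷≈ ≈D-refl

del-three-mid : ∀ {θ1 θ2 a b s w} → θ1 ≤ s → s < θ2 → s ∉ w →
  del (shapeDivision (three θ1 θ2 (suc a) b) (s ∷ w)) (suc (suc a + 0)) s ≈D shapeDivision (three θ1 s a b) w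
del-three-mid {θ1} {θ2} {a} {b} {s} {w} le lt nd =
  subst (_≈D shapeDivision (three θ1 s a b) w)
      (sym (delAt-[]∷-gaps-++ _ a (below θ2 (atLeast θ1 (s ∷ w))) (atLeast θ2 (s ∷ w) ∷ gaps b) 0 s))
    (below-∷-≥ le ∷≈ gaps-++-resp-≈D a (below-mid-∷ le lt nd ∷≈ above-mid-++-high le lt nd ∷≈ ≈D-refl))

del-three-mid₀ : ∀ {θ1 θ2 b s w} → θ1 ≤ s → s < θ2 → s ∉ w →
  del (shapeDivision (three θ1 θ2 0 b) (s ∷ w)) 1 s ≈D shapeDivision (adjacent s b) w
del-three-mid₀ le lt nd = low-++-below-mid le lt nd ∷≈ above-mid-++-high le lt nd ∷≈ ≈D-refl

del-three-high : ∀ {θ1 θ2 a b s w} → θ1 ≤ θ2 → θ2 ≤ s → s ∉ w →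
  del (shapeDivision (three θ1 θ2 a (suc b)) (s ∷ w)) (suc (a + 1)) s ≈D shapeDivision (three θ1 s a b) w
del-three-high {a = zero} le12 le nd = below-∷-≥ (≤-trans le12 le)
  ∷≈ mid-++-below-high le12 le nd ∷≈ above-atLeast-∷ le nd ∷≈ ≈D-refl
del-three-high {θ1} {θ2} {suc a} {b} {s} {w} le12 le nd =
  subst (_≈D shapeDivision (three θ1 s (suc a) b) w)
      (sym (delAt-[]∷-gaps-++ _ a (below θ2 (atLeast θ1 (s ∷ w))) (atLeast θ2 (s ∷ w) ∷ [] ∷ gaps b) 1 s))
    (below-∷-≥ (≤-trans le12 le) ∷≈
      subst (_≈D ([] ∷ (gaps a ++ (below s (atLeast θ1 w) ∷ atLeast s w ∷ gaps b)))) (sym (gaps-++-[]∷ a _))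
        (≋-refl ∷≈ gaps-++-resp-≈D a (mid-++-below-high le12 le nd ∷≈ above-atLeast-∷ le nd ∷≈ ≈D-refl)))

del-three-high₀ : ∀ {θ1 θ2 a s w} → θ1 ≤ θ2 → θ2 ≤ s → UpperBoundFrom θ2 s w → s ∉ w →
  del (shapeDivision (three θ1 θ2 a 0) (s ∷ w)) (suc (a + 1)) s ≈D shapeDivision (apart θ1 a) w
del-three-high₀ {a = zero} le12 le hi nd = below-∷-≥ (≤-trans le12 le) ∷≈ mid-++-below-max le12 le hi nd ∷≈ []≈
del-three-high₀ {θ1} {θ2} {suc a} {s} {w} le12 le hi nd =
  subst (_≈D shapeDivision (apart θ1 (suc a)) w)
      (sym (delAt-[]∷-gaps-++ _ a (below θ2 (atLeast θ1 (s ∷ w))) (atLeast θ2 (s ∷ w) ∷ []) 1 s))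
    (below-∷-≥ (≤-trans le12 le) ∷≈
      subst (_≈D ([] ∷ (gaps a ++ (atLeast θ1 w ∷ [])))) (sym (gaps-++-[]∷ a _))
        (≋-refl ∷≈ gaps-++-resp-≈D a (mid-++-below-max le12 le hi nd ∷≈ []≈)))

del-apart-low : ∀ {θ a s w} → s < θ → LowerBoundBelow θ s w → s ∉ w →
  del (shapeDivision (apart θ (suc a)) (s ∷ w)) 0 s ≈D shapeDivision (apart θ a) w
del-apart-low {a = a} s<θ lo nd = ++[]-resp-≋ (above-min-below s<θ lo nd) ∷≈ gaps-++-resp-≈D a (atLeast-∷-< s<θ ∷≈ []≈)

del-apart-low₀ : ∀ {θ s w} → s < θ → LowerBoundBelow θ s w → s ∉ w →
  del (shapeDivision (apart θ 0) (s ∷ w)) 0 s ≈D shapeDivision (one 0) w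
del-apart-low₀ s<θ lo nd = above-min-++-atLeast s<θ lo nd ∷≈ []≈

del-apart-high : ∀ {θ a s w} → θ ≤ s → UpperBoundFrom θ s w → s ∉ w →
  del (shapeDivision (apart θ (suc a)) (s ∷ w)) (suc (suc a + 0)) s ≈D shapeDivision (apart θ a) w
del-apart-high {θ} {a} {s} {w} le hi nd =
  subst (_≈D shapeDivision (apart θ a) w) (sym (delAt-[]∷-gaps-++ _ a (atLeast θ (s ∷ w)) [] 0 s))
    (below-∷-≥ le ∷≈ gaps-++-resp-≈D a (below-max-atLeast le hi nd ∷≈ []≈))

del-apart-high₀ : ∀ {θ s w} → θ ≤ s → UpperBoundFrom θ s w → s ∉ w →
  del (shapeDivision (apart θ 0) (s ∷ w)) 1 s ≈D shapeDivision (one 0) w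
del-apart-high₀ le hi nd = low-++-below-max le hi nd ∷≈ []≈

del-adjacent-low : ∀ {θ b s w} → s < θ → LowerBoundBelow θ s w → s ∉ w →
  del (shapeDivision (adjacent θ b) (s ∷ w)) 0 s ≈D shapeDivision (one b) w
del-adjacent-low s<θ lo nd = above-min-++-atLeast s<θ lo nd ∷≈ ≈D-refl

del-adjacent-high : ∀ {θ b s w} → θ ≤ s → s ∉ w →
  del (shapeDivision (adjacent θ (suc b)) (s ∷ w)) 1 s ≈D shapeDivision (adjacent s b) w
del-adjacent-high le nd = low-++-below-atLeast le nd ∷≈ above-atLeast-∷ le nd ∷≈ ≈D-refl

del-adjacent-high₀ : ∀ {θ s w} → θ ≤ s → UpperBoundFrom θ s w → s ∉ w →
  del (shapeDivision (adjacent θ 0) (s ∷ w)) 1 s ≈D shapeDivision (one 0) w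
del-adjacent-high₀ le hi nd = low-++-below-max le hi nd ∷≈ []≈

del-one-min : ∀ {b s w} → LowerBound s w → s ∉ w → del (shapeDivision (one (suc b)) (s ∷ w)) 0 s ≈D shapeDivision (one b) w
del-one-min lo nd = ++[]-resp-≋ (above-min-∷ lo nd) ∷≈ ≈D-refl

del-one-min₀ : ∀ {s w} → LowerBound s w → s ∉ w → del (shapeDivision (one 0) (s ∷ w)) 0 s ≈D shapeDivision (one 0) w
del-one-min₀ lo nd = above-min-∷ lo nd ∷≈ []≈


-- Runs are exactly the C-permutations

length-three : ∀ θ1 θ2 a b w → length (shapeDivision (three θ1 θ2 a b) w) ≡ suc (a + suc (suc b))
length-three θ1 θ2 a b w = cong suc (trans (length-gaps-++ a _) (cong (λ z → a + suc (suc z)) (length-replicate b)))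

length-apart : ∀ θ a w → length (shapeDivision (apart θ a) w) ≡ suc (a + 1)
length-apart θ a w = cong suc (length-gaps-++ a _)

three-length≢1 : ∀ θ1 θ2 a b w → 1 ≢ length (shapeDivision (three θ1 θ2 a b) w)
three-length≢1 θ1 θ2 a b w e rewrite length-three θ1 θ2 a b w | +-suc a (suc b) with e
... | ()

apart-length≢1 : ∀ θ a w → 1 ≢ length (shapeDivision (apart θ a) w)
apart-length≢1 θ a w e rewrite length-apart θ a w | +-suc a 0 with e
... | ()

-- In `three θ1 θ2 a b` the middle block has index 1 + a and the high block 2 + a, written
-- a + 0 and a + 1 after the leading block so that block-gaps-++ applies.
three-mid-inner : ∀ θ1 θ2 a b w → suc (suc (a + 0)) < length (shapeDivision (three θ1 θ2 a b) w)
three-mid-inner θ1 θ2 a b w rewrite length-three θ1 θ2 a b w | +-identityʳ a | +-suc a (suc b) | +-suc a b =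
  s≤s (s≤s (s≤s (m≤m+n a b)))

three-high-inner : ∀ θ1 θ2 a b w → suc (suc (a + 1)) < length (shapeDivision (three θ1 θ2 a (suc b)) w)
three-high-inner θ1 θ2 a b w
  rewrite length-three θ1 θ2 a (suc b) w | +-suc a 0 | +-identityʳ a | +-suc a (suc (suc b)) | +-suc a (suc b) | +-suc a b =
  s≤s (s≤s (s≤s (s≤s (m≤m+n a b))))

three-high-last : ∀ θ1 θ2 a w → suc (suc (a + 1)) ≡ length (shapeDivision (three θ1 θ2 a 0) w)
three-high-last θ1 θ2 a w = trans (cong suc (sym (+-suc a 1))) (sym (length-three θ1 θ2 a 0 w))

apart-high-last : ∀ θ a w → suc (suc (a + 0)) ≡ length (shapeDivision (apart θ a) w)
apart-high-last θ a w = trans (cong suc (sym (+-suc a 0))) (sym (length-apart θ a w))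

min-first : ∀ {θ s w} → LowerBoundBelow θ s w → ∀ t → t ∈ below θ (s ∷ w) → s ≤ t
min-first {θ} {s} {w} lo t p with below⁻ θ (s ∷ w) p
... | here refl , _ = ≤-refl
... | there m , t<θ = lo t m t<θ

max-last : ∀ {θ s w} → UpperBoundFrom θ s w → ∀ t → t ∈ atLeast θ (s ∷ w) → t ≤ s
max-last {θ} {s} {w} hi t p with atLeast⁻ θ (s ∷ w) p
... | here refl , _ = ≤-refl
... | there m , θ≤t = hi t m θ≤t

min-∷-first : ∀ {s w} → LowerBound s w → ∀ t → t ∈ s ∷ w → s ≤ t
min-∷-first lo t (here refl) = ≤-refl
min-∷-first lo t (there m) = lo t m

first-low : ∀ {θ s w D} → s < θ → LowerBoundBelow θ s w → Adm (below θ (s ∷ w) ∷ D) s 0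
first-low {θ} {s} {w} s<θ lo = first (below⁺ θ (s ∷ w) (here refl) s<θ) (min-first lo)

IsCPerm-∷ : ∀ {D D' s i w} → Adm D s i → del D i s ≈D D' → IsCPerm D' w → IsCPerm D (s ∷ w)
IsCPerm-∷ adm e rest = adm ∷ IsCPerm-resp-≈D (≈D-sym e) rest

Run⇒IsCPerm : ∀ σ w → Ordered σ → Distinct w → Run σ w → IsCPerm (shapeDivision σ w) w
Run⇒IsCPerm σ [] ok dw done = []
Run⇒IsCPerm (three θ1 θ2 (suc a) b) (s ∷ w) ok (nd , dw) (three-low s<θ1 lo r) =
  IsCPerm-∷ (first-low s<θ1 lo) (del-three-low s<θ1 ok lo nd) (Run⇒IsCPerm _ w ok dw r)
Run⇒IsCPerm (three θ1 θ2 zero b) (s ∷ w) ok (nd , dw) (three-low₀ s<θ1 lo r) =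
  IsCPerm-∷ (first-low s<θ1 lo) (del-three-low₀ s<θ1 ok lo nd) (Run⇒IsCPerm _ w tt dw r)
Run⇒IsCPerm (three θ1 θ2 (suc a) b) (s ∷ w) ok (nd , dw) (three-mid le lt r) =
  IsCPerm-∷ (mid z<s (three-mid-inner θ1 θ2 (suc a) b (s ∷ w))
               (subst (s ∈_) (sym (block-gaps-++ (suc a) (below θ2 (atLeast θ1 (s ∷ w)) ∷ atLeast θ2 (s ∷ w) ∷ gaps b) 0))
                 (below⁺ θ2 _ (atLeast⁺ θ1 (s ∷ w) (here refl) le) lt)))
    (del-three-mid le lt nd) (Run⇒IsCPerm _ w le dw r)
Run⇒IsCPerm (three θ1 θ2 zero b) (s ∷ w) ok (nd , dw) (three-mid₀ le lt r) =
  IsCPerm-∷ (mid z<s (three-mid-inner θ1 θ2 0 b (s ∷ w)) (below⁺ θ2 _ (atLeast⁺ θ1 (s ∷ w) (here refl) le) lt))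
    (del-three-mid₀ le lt nd) (Run⇒IsCPerm _ w tt dw r)
Run⇒IsCPerm (three θ1 θ2 a (suc b)) (s ∷ w) ok (nd , dw) (three-high le r) =
  IsCPerm-∷ (mid z<s (three-high-inner θ1 θ2 a b (s ∷ w))
               (subst (s ∈_) (sym (block-gaps-++ a (below θ2 (atLeast θ1 (s ∷ w)) ∷ atLeast θ2 (s ∷ w) ∷ gaps (suc b)) 1))
                 (atLeast⁺ θ2 (s ∷ w) (here refl) le)))
    (del-three-high ok le nd) (Run⇒IsCPerm _ w (≤-trans ok le) dw r)
Run⇒IsCPerm (three θ1 θ2 a zero) (s ∷ w) ok (nd , dw) (three-high₀ le hi r) =
  IsCPerm-∷ (last (three-high-last θ1 θ2 a (s ∷ w))
               (subst (s ∈_) (sym (block-gaps-++ a Ds 1)) (atLeast⁺ θ2 (s ∷ w) (here refl) le))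
               (λ t p → max-last hi t (subst (t ∈_) (block-gaps-++ a Ds 1) p)))
    (del-three-high₀ ok le hi nd) (Run⇒IsCPerm _ w tt dw r)
  where Ds = below θ2 (atLeast θ1 (s ∷ w)) ∷ atLeast θ2 (s ∷ w) ∷ []
Run⇒IsCPerm (apart θ (suc a)) (s ∷ w) ok (nd , dw) (apart-low s<θ lo r) =
  IsCPerm-∷ (first-low s<θ lo) (del-apart-low s<θ lo nd) (Run⇒IsCPerm _ w tt dw r)
Run⇒IsCPerm (apart θ zero) (s ∷ w) ok (nd , dw) (apart-low₀ s<θ lo r) =
  IsCPerm-∷ (first-low s<θ lo) (del-apart-low₀ s<θ lo nd) (Run⇒IsCPerm _ w tt dw r)
Run⇒IsCPerm (apart θ (suc a)) (s ∷ w) ok (nd , dw) (apart-high le hi r) =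
  IsCPerm-∷ (last (apart-high-last θ (suc a) (s ∷ w))
               (subst (s ∈_) (sym (block-gaps-++ (suc a) Ds 0)) (atLeast⁺ θ (s ∷ w) (here refl) le))
               (λ t p → max-last hi t (subst (t ∈_) (block-gaps-++ (suc a) Ds 0) p)))
    (del-apart-high le hi nd) (Run⇒IsCPerm _ w tt dw r)
  where Ds = atLeast θ (s ∷ w) ∷ []
Run⇒IsCPerm (apart θ zero) (s ∷ w) ok (nd , dw) (apart-high₀ le hi r) =
  IsCPerm-∷ (last refl (atLeast⁺ θ (s ∷ w) (here refl) le) (max-last hi))
    (del-apart-high₀ le hi nd) (Run⇒IsCPerm _ w tt dw r)
Run⇒IsCPerm (adjacent θ b) (s ∷ w) ok (nd , dw) (adjacent-low s<θ lo r) =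
  IsCPerm-∷ (first-low s<θ lo) (del-adjacent-low s<θ lo nd) (Run⇒IsCPerm _ w tt dw r)
Run⇒IsCPerm (adjacent θ (suc b)) (s ∷ w) ok (nd , dw) (adjacent-high le r) =
  IsCPerm-∷ (mid z<s (s≤s (s≤s z<s)) (atLeast⁺ θ (s ∷ w) (here refl) le))
    (del-adjacent-high le nd) (Run⇒IsCPerm _ w tt dw r)
Run⇒IsCPerm (adjacent θ zero) (s ∷ w) ok (nd , dw) (adjacent-high₀ le hi r) =
  IsCPerm-∷ (last refl (atLeast⁺ θ (s ∷ w) (here refl) le) (max-last hi))
    (del-adjacent-high₀ le hi nd) (Run⇒IsCPerm _ w tt dw r)
Run⇒IsCPerm (one (suc b)) (s ∷ w) ok (nd , dw) (one-min lo r) =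
  IsCPerm-∷ (first (here refl) (min-∷-first lo)) (del-one-min lo nd) (Run⇒IsCPerm _ w tt dw r)
Run⇒IsCPerm (one zero) (s ∷ w) ok (nd , dw) (one-min₀ lo r) =
  IsCPerm-∷ (first (here refl) (min-∷-first lo)) (del-one-min₀ lo nd) (Run⇒IsCPerm _ w tt dw r)

first⇒LowerBoundBelow : ∀ {θ s w} → (∀ t → t ∈ below θ (s ∷ w) → s ≤ t) → LowerBoundBelow θ s w
first⇒LowerBoundBelow {θ} {s} f x xm x<θ = f x (below⁺ θ (s ∷ _) (there xm) x<θ)

last⇒UpperBoundFrom : ∀ {θ s w} → (∀ t → t ∈ atLeast θ (s ∷ w) → t ≤ s) → UpperBoundFrom θ s w
last⇒UpperBoundFrom {θ} {s} f x xm θ≤x = f x (atLeast⁺ θ (s ∷ _) (there xm) θ≤x)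

RunsFrom : List ℕ → Set
RunsFrom w = ∀ σ → Ordered σ → IsCPerm (shapeDivision σ w) w → Run σ w

step-three-high : ∀ θ1 θ2 a b s w → θ1 ≤ θ2 → s ∉ w → RunsFrom w → s ∈ atLeast θ2 (s ∷ w) →
  Adm (shapeDivision (three θ1 θ2 a b) (s ∷ w)) s (suc (a + 1)) →
  IsCPerm (del (shapeDivision (three θ1 θ2 a b) (s ∷ w)) (suc (a + 1)) s) w → Run (three θ1 θ2 a b) (s ∷ w)
step-three-high θ1 θ2 a (suc b) s w ok nd ih m adm rest =
  let le = proj₂ (atLeast⁻ θ2 (s ∷ w) m) in
  three-high le (ih (three θ1 s a b) (≤-trans ok le) (IsCPerm-resp-≈D (del-three-high ok le nd) rest))
step-three-high θ1 θ2 a zero s w ok nd ih m (last e _ f) rest =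
  let le = proj₂ (atLeast⁻ θ2 (s ∷ w) m)
      Ds = below θ2 (atLeast θ1 (s ∷ w)) ∷ atLeast θ2 (s ∷ w) ∷ []
      hi = last⇒UpperBoundFrom (λ t p → f t (subst (t ∈_) (sym (block-gaps-++ a Ds 1)) p))
  in three-high₀ le hi (ih (apart θ1 a) tt (IsCPerm-resp-≈D (del-three-high₀ ok le hi nd) rest))
step-three-high θ1 θ2 a zero s w ok nd ih m (mid _ l _) rest = ⊥-elim (<-irrefl (three-high-last θ1 θ2 a (s ∷ w)) l)

step-apart-high : ∀ θ a s w → s ∉ w → RunsFrom w → s ∈ atLeast θ (s ∷ w) →
  Adm (shapeDivision (apart θ a) (s ∷ w)) s (suc (a + 0)) →
  IsCPerm (del (shapeDivision (apart θ a) (s ∷ w)) (suc (a + 0)) s) w → Run (apart θ a) (s ∷ w)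
step-apart-high θ a s w nd ih m (mid _ l _) rest = ⊥-elim (<-irrefl (apart-high-last θ a (s ∷ w)) l)
step-apart-high θ zero s w nd ih m (last e _ f) rest =
  let le = proj₂ (atLeast⁻ θ (s ∷ w) m) ; hi = last⇒UpperBoundFrom f in
  apart-high₀ le hi (ih (one 0) tt (IsCPerm-resp-≈D (del-apart-high₀ le hi nd) rest))
step-apart-high θ (suc a) s w nd ih m (last e _ f) rest =
  let le = proj₂ (atLeast⁻ θ (s ∷ w) m)
      hi = last⇒UpperBoundFrom (λ t p → f t (subst (t ∈_) (sym (block-gaps-++ (suc a) (atLeast θ (s ∷ w) ∷ []) 0)) p))
  in apart-high le hi (ih (apart θ a) tt (IsCPerm-resp-≈D (del-apart-high le hi nd) rest))

step-three : ∀ θ1 θ2 a b s w → θ1 ≤ θ2 → s ∉ w → RunsFrom w →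
  ∀ i → Adm (shapeDivision (three θ1 θ2 a b) (s ∷ w)) s i →
  IsCPerm (del (shapeDivision (three θ1 θ2 a b) (s ∷ w)) i s) w → Run (three θ1 θ2 a b) (s ∷ w)
step-three θ1 θ2 a b s w ok nd ih zero (last e _ _) rest = ⊥-elim (three-length≢1 θ1 θ2 a b (s ∷ w) e)
step-three θ1 θ2 a b s w ok nd ih zero (mid () _ _) rest
step-three θ1 θ2 zero b s w ok nd ih zero (first m f) rest =
  let s<θ1 = proj₂ (below⁻ θ1 (s ∷ w) m) ; lo = first⇒LowerBoundBelow f in
  three-low₀ s<θ1 lo (ih (adjacent θ2 b) tt (IsCPerm-resp-≈D (del-three-low₀ s<θ1 ok lo nd) rest))
step-three θ1 θ2 (suc a) b s w ok nd ih zero (first m f) rest =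
  let s<θ1 = proj₂ (below⁻ θ1 (s ∷ w) m) ; lo = first⇒LowerBoundBelow f in
  three-low s<θ1 lo (ih (three θ1 θ2 a b) ok (IsCPerm-resp-≈D (del-three-low s<θ1 ok lo nd) rest))
step-three θ1 θ2 zero b s w ok nd ih (suc zero) adm rest =
  let (q , lt) = below⁻ θ2 _ (Adm⇒∈-block adm) ; le = proj₂ (atLeast⁻ θ1 (s ∷ w) q) in
  three-mid₀ le lt (ih (adjacent s b) tt (IsCPerm-resp-≈D (del-three-mid₀ le lt nd) rest))
step-three θ1 θ2 zero b s w ok nd ih (suc (suc zero)) adm rest =
  step-three-high θ1 θ2 zero b s w ok nd ih (Adm⇒∈-block adm) adm rest
step-three θ1 θ2 zero b s w ok nd ih (suc (suc (suc j))) adm rest = ⊥-elim (∉-block-gaps b j (Adm⇒∈-block adm))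
step-three θ1 θ2 (suc a) b s w ok nd ih (suc zero) adm rest with Adm⇒∈-block adm
... | ()
step-three θ1 θ2 (suc a) b s w ok nd ih (suc (suc i)) adm rest
  with block-gaps-++⁻ a (below θ2 (atLeast θ1 (s ∷ w)) ∷ atLeast θ2 (s ∷ w) ∷ gaps b) i (Adm⇒∈-block adm)
... | zero , refl , m =
  let (q , lt) = below⁻ θ2 _ m ; le = proj₂ (atLeast⁻ θ1 (s ∷ w) q) in
  three-mid le lt (ih (three θ1 s a b) le (IsCPerm-resp-≈D (del-three-mid le lt nd) rest))
... | suc zero , refl , m = step-three-high θ1 θ2 (suc a) b s w ok nd ih m adm rest
... | suc (suc j) , refl , m = ⊥-elim (∉-block-gaps b j m)

step-apart : ∀ θ a s w → s ∉ w → RunsFrom w → ∀ i → Adm (shapeDivision (apart θ a) (s ∷ w)) s i →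
  IsCPerm (del (shapeDivision (apart θ a) (s ∷ w)) i s) w → Run (apart θ a) (s ∷ w)
step-apart θ a s w nd ih zero (last e _ _) rest = ⊥-elim (apart-length≢1 θ a (s ∷ w) e)
step-apart θ a s w nd ih zero (mid () _ _) rest
step-apart θ zero s w nd ih zero (first m f) rest =
  let s<θ = proj₂ (below⁻ θ (s ∷ w) m) ; lo = first⇒LowerBoundBelow f in
  apart-low₀ s<θ lo (ih (one 0) tt (IsCPerm-resp-≈D (del-apart-low₀ s<θ lo nd) rest))
step-apart θ (suc a) s w nd ih zero (first m f) rest =
  let s<θ = proj₂ (below⁻ θ (s ∷ w) m) ; lo = first⇒LowerBoundBelow f in
  apart-low s<θ lo (ih (apart θ a) tt (IsCPerm-resp-≈D (del-apart-low s<θ lo nd) rest))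
step-apart θ zero s w nd ih (suc zero) adm rest = step-apart-high θ zero s w nd ih (Adm⇒∈-block adm) adm rest
step-apart θ zero s w nd ih (suc (suc j)) adm rest with Adm⇒∈-block adm
... | ()
step-apart θ (suc a) s w nd ih (suc zero) adm rest with Adm⇒∈-block adm
... | ()
step-apart θ (suc a) s w nd ih (suc (suc i)) adm rest with block-gaps-++⁻ a (atLeast θ (s ∷ w) ∷ []) i (Adm⇒∈-block adm)
... | zero , refl , m = step-apart-high θ (suc a) s w nd ih m adm rest
... | suc j , refl , ()

step-adjacent : ∀ θ b s w → s ∉ w → RunsFrom w → ∀ i → Adm (shapeDivision (adjacent θ b) (s ∷ w)) s i →
  IsCPerm (del (shapeDivision (adjacent θ b) (s ∷ w)) i s) w → Run (adjacent θ b) (s ∷ w)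
step-adjacent θ b s w nd ih zero (last () _ _) rest
step-adjacent θ b s w nd ih zero (mid () _ _) rest
step-adjacent θ b s w nd ih zero (first m f) rest =
  let s<θ = proj₂ (below⁻ θ (s ∷ w) m) ; lo = first⇒LowerBoundBelow f in
  adjacent-low s<θ lo (ih (one b) tt (IsCPerm-resp-≈D (del-adjacent-low s<θ lo nd) rest))
step-adjacent θ (suc b) s w nd ih (suc zero) adm rest =
  let le = proj₂ (atLeast⁻ θ (s ∷ w) (Adm⇒∈-block adm)) in
  adjacent-high le (ih (adjacent s b) tt (IsCPerm-resp-≈D (del-adjacent-high le nd) rest))
step-adjacent θ zero s w nd ih (suc zero) (last e m f) rest =
  let le = proj₂ (atLeast⁻ θ (s ∷ w) m) ; hi = last⇒UpperBoundFrom f in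
  adjacent-high₀ le hi (ih (one 0) tt (IsCPerm-resp-≈D (del-adjacent-high₀ le hi nd) rest))
step-adjacent θ zero s w nd ih (suc zero) (mid _ (s≤s (s≤s ())) _) rest
step-adjacent θ b s w nd ih (suc (suc j)) adm rest = ⊥-elim (∉-block-gaps b j (Adm⇒∈-block adm))

-- Deleting the maximum of the only block leaves the elements above it, that is, none.
single-block-max : ∀ {s w} → (∀ t → t ∈ s ∷ w → t ≤ s) → IsCPerm (above s (s ∷ w) ∷ []) w → LowerBound s w
single-block-max {s} {[]} f c = λ x ()
single-block-max {s} {x ∷ w} f (_∷_ {i = zero} adm rest) =
  ⊥-elim (<⇒≱ (proj₂ (above⁻ s (s ∷ x ∷ w) (Adm⇒∈-block adm))) (f x (there (here refl))))
single-block-max {s} {x ∷ w} f (_∷_ {i = suc i} adm rest) with Adm⇒∈-block adm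
... | ()

step-one : ∀ b s w → s ∉ w → RunsFrom w → ∀ i → Adm (shapeDivision (one b) (s ∷ w)) s i →
  IsCPerm (del (shapeDivision (one b) (s ∷ w)) i s) w → Run (one b) (s ∷ w)
step-one b s w nd ih zero (mid () _ _) rest
step-one (suc b) s w nd ih zero (last () _ _) rest
step-one (suc b) s w nd ih zero (first m f) rest =
  let lo = λ x xm → f x (there xm) in
  one-min lo (ih (one b) tt (IsCPerm-resp-≈D (del-one-min lo nd) rest))
step-one zero s w nd ih zero (first m f) rest =
  let lo = λ x xm → f x (there xm) in
  one-min₀ lo (ih (one 0) tt (IsCPerm-resp-≈D (del-one-min₀ lo nd) rest))
step-one zero s w nd ih zero (last e m f) rest =
  let lo = single-block-max f rest in
  one-min₀ lo (ih (one 0) tt (IsCPerm-resp-≈D (del-one-min₀ lo nd) rest))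
step-one b s w nd ih (suc j) adm rest = ⊥-elim (∉-block-gaps b j (Adm⇒∈-block adm))

IsCPerm⇒Run : ∀ σ w → Ordered σ → Distinct w → IsCPerm (shapeDivision σ w) w → Run σ w
IsCPerm⇒Run σ [] ok dw c = done
IsCPerm⇒Run σ (s ∷ w) ok (nd , dw) (_∷_ {i = i} adm rest) = step σ ok i adm rest
  where
  ih : RunsFrom w
  ih σ' ok' = IsCPerm⇒Run σ' w ok' dw
  step : ∀ σ → Ordered σ → ∀ i → Adm (shapeDivision σ (s ∷ w)) s i →
      IsCPerm (del (shapeDivision σ (s ∷ w)) i s) w → Run σ (s ∷ w)
  step (three θ1 θ2 a b) ok = step-three θ1 θ2 a b s w ok nd ih
  step (apart θ a) _ = step-apart θ a s w nd ih
  step (adjacent θ b) _ = step-adjacent θ b s w nd ih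
  step (one b) _ = step-one b s w nd ih

IsCPerm⇔Run : ∀ σ w → Ordered σ → Distinct w → IsCPerm (shapeDivision σ w) w ⇔ Run σ w
IsCPerm⇔Run σ w ok dw = mk⇔ (IsCPerm⇒Run σ w ok dw) (Run⇒IsCPerm σ w ok dw)


-- Descents of lists

embed : List ℕ → List Ext
embed = map just

All-embed⁺ : ∀ {P : Ext → Set} {w} → (∀ x → x ∈ w → P (just x)) → All P (embed w)
All-embed⁺ f = AllP.map⁺ (All.tabulate (λ {x} → f x))

All-embed⁻ : ∀ {P : Ext → Set} {w} → All P (embed w) → ∀ x → x ∈ w → P (just x)
All-embed⁻ a x m = All.lookup (AllP.map⁻ a) m

module Descents (c t : ℕ) where

  InC₁ : Ext → Set
  InC₁ = InC1 c

  _≺_ : Ext → Ext → Set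
  x ≺ y = x <[ t ] y

  data NextBelow (x : Ext) : List Ext → Set where
    below-here  : ∀ {y ys} → ¬ InC₁ y → y ≺ x → NextBelow x (y ∷ ys)
    below-there : ∀ {y ys} → InC₁ y → NextBelow x ys → NextBelow x (y ∷ ys)

  Descent : Ext → List Ext → Set
  Descent x ys = InC₁ x ⊎ NextBelow x ys

  Increasing : List Ext → Set
  Increasing = AllPairs _≺_

  -- DescentForm d xs: xs has at least d C₁-descents and is increasing after the d-th one,
  -- i.e. conditions (b) and (c), read off the list from the left.
  data DescentForm : ℕ → List Ext → Set where
    final   : ∀ {x xs} → Descent x xs → Increasing xs → DescentForm 1 (x ∷ xs)
    descent : ∀ {d x xs} → Descent x xs → DescentForm (suc d) xs → DescentForm (suc (suc d)) (x ∷ xs)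
    plain   : ∀ {d x xs} → ¬ Descent x xs → DescentForm (suc d) xs → DescentForm (suc d) (x ∷ xs)

  InC₁? : ∀ x → Dec (InC₁ x)
  InC₁? nothing = no (λ ())
  InC₁? (just a) = a <? c

  ≺? : ∀ x y → Dec (x ≺ y)
  ≺? (just a) (just b) = a <? b
  ≺? (just a) nothing = a <? t
  ≺? nothing (just b) = t ≤? b
  ≺? nothing nothing = no (λ ())

  NextBelow? : ∀ x ys → Dec (NextBelow x ys)
  NextBelow? x [] = no (λ ())
  NextBelow? x (y ∷ ys) with InC₁? y
  ... | no ¬ic with ≺? y x
  ...   | yes lt = yes (below-here ¬ic lt)
  ...   | no ¬lt = no (λ { (below-here _ lt) → ¬lt lt ; (below-there ic _) → ¬ic ic })
  NextBelow? x (y ∷ ys) | yes ic with NextBelow? x ys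
  ...   | yes n = yes (below-there ic n)
  ...   | no ¬n = no (λ { (below-here ¬ic _) → ¬ic ic ; (below-there _ n) → ¬n n })

  Descent? : ∀ x ys → Dec (Descent x ys)
  Descent? x ys with InC₁? x
  ... | yes ic = yes (inj₁ ic)
  ... | no ¬ic with NextBelow? x ys
  ...   | yes n = yes (inj₂ n)
  ...   | no ¬n = no (λ { (inj₁ ic) → ¬ic ic ; (inj₂ n) → ¬n n })

  ≺-trans : ∀ {x y z} → x ≺ y → y ≺ z → x ≺ z
  ≺-trans {just a} {just b} {just d} p q = <-trans p q
  ≺-trans {just a} {just b} {nothing} p q = <-trans p q
  ≺-trans {just a} {nothing} {just d} p q = <-≤-trans p q
  ≺-trans {just a} {nothing} {nothing} p ()
  ≺-trans {nothing} {just b} {just d} p q = ≤-trans p (<⇒≤ q)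
  ≺-trans {nothing} {just b} {nothing} p q = ⊥-elim (<⇒≱ q p)
  ≺-trans {nothing} {nothing} {z} () q

  Descent-skip-C₁ : ∀ {p y ys} → ¬ InC₁ p → InC₁ y → Descent p (y ∷ ys) ⇔ Descent p ys
  Descent-skip-C₁ ¬icp icy = mk⇔
    (λ { (inj₁ i) → ⊥-elim (¬icp i) ; (inj₂ (below-here ¬i _)) → ⊥-elim (¬i icy) ; (inj₂ (below-there _ n)) → inj₂ n })
    (λ { (inj₁ i) → ⊥-elim (¬icp i) ; (inj₂ n) → inj₂ (below-there icy n) })

  ¬Descent-over : ∀ {p y ys} → ¬ InC₁ p → ¬ InC₁ y → ¬ (y ≺ p) → ¬ Descent p (y ∷ ys)
  ¬Descent-over ¬icp ¬icy ¬lt (inj₁ i) = ¬icp i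
  ¬Descent-over ¬icp ¬icy ¬lt (inj₂ (below-here _ lt)) = ¬lt lt
  ¬Descent-over ¬icp ¬icy ¬lt (inj₂ (below-there i _)) = ¬icy i

  DescentForm-skip-C₁ : ∀ {d p y ys} → ¬ InC₁ p → InC₁ y →
    DescentForm (suc (suc d)) (p ∷ y ∷ ys) ⇔ DescentForm (suc d) (p ∷ ys)
  DescentForm-skip-C₁ {d} {p} {y} {ys} ¬icp icy = mk⇔ f g
    where
    skip = Descent-skip-C₁ {p} {y} {ys} ¬icp icy
    f : DescentForm (suc (suc d)) (p ∷ y ∷ ys) → DescentForm (suc d) (p ∷ ys)
    f (descent dp (final _ inc)) = final (to skip dp) inc
    f (descent dp (descent _ sp)) = descent (to skip dp) sp
    f (descent dp (plain ¬dy _)) = ⊥-elim (¬dy (inj₁ icy))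
    f (plain ¬dp (descent _ sp)) = plain (λ d' → ¬dp (from skip d')) sp
    f (plain ¬dp (plain ¬dy _)) = ⊥-elim (¬dy (inj₁ icy))
    g : DescentForm (suc d) (p ∷ ys) → DescentForm (suc (suc d)) (p ∷ y ∷ ys)
    g (final dp inc) = descent (from skip dp) (final (inj₁ icy) inc)
    g (descent dp sp) = descent (from skip dp) (descent (inj₁ icy) sp)
    g (plain ¬dp sp) = plain (λ d' → ¬dp (to skip d')) (descent (inj₁ icy) sp)

  DescentForm-descent : ∀ {d p y ys} → ¬ InC₁ y → y ≺ p →
    DescentForm (suc (suc d)) (p ∷ y ∷ ys) ⇔ DescentForm (suc d) (y ∷ ys)
  DescentForm-descent ¬icy lt = mk⇔
    (λ { (descent _ sp) → sp ; (plain ¬dp _) → ⊥-elim (¬dp (inj₂ (below-here ¬icy lt))) })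
    (descent (inj₂ (below-here ¬icy lt)))

  DescentForm-final : ∀ {p y ys} → ¬ InC₁ y → y ≺ p → DescentForm 1 (p ∷ y ∷ ys) ⇔ Increasing (y ∷ ys)
  DescentForm-final ¬icy lt = mk⇔
    (λ { (final _ inc) → inc ; (plain ¬dp _) → ⊥-elim (¬dp (inj₂ (below-here ¬icy lt))) })
    (final (inj₂ (below-here ¬icy lt)))

  DescentForm-plain : ∀ {d p y ys} → ¬ InC₁ p → ¬ InC₁ y → ¬ (y ≺ p) →
    DescentForm (suc d) (p ∷ y ∷ ys) ⇔ DescentForm (suc d) (y ∷ ys)
  DescentForm-plain ¬icp ¬icy ¬lt = mk⇔
    (λ { (final dp _) → ⊥-elim (¬Descent-over ¬icp ¬icy ¬lt dp)
       ; (descent dp _) → ⊥-elim (¬Descent-over ¬icp ¬icy ¬lt dp)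
       ; (plain _ sp) → sp })
    (plain (¬Descent-over ¬icp ¬icy ¬lt))

  DescentForm-pair : ∀ {q y} → ¬ InC₁ q → DescentForm 1 (q ∷ just y ∷ []) ⇔ (¬ InC₁ (just y) → just y ≺ q)
  DescentForm-pair {q} {y} ¬icq = mk⇔ f g
    where
    f : DescentForm 1 (q ∷ just y ∷ []) → ¬ InC₁ (just y) → just y ≺ q
    f (final (inj₁ i) _) _ = ⊥-elim (¬icq i)
    f (final (inj₂ (below-here _ lt)) _) _ = lt
    f (final (inj₂ (below-there i _)) _) ¬i = ⊥-elim (¬i i)
    f (plain _ (final (inj₁ i) _)) ¬i = ⊥-elim (¬i i)
    f (plain _ (final (inj₂ ()) _)) ¬i
    f (plain _ (plain _ ())) ¬i
    g : (¬ InC₁ (just y) → just y ≺ q) → DescentForm 1 (q ∷ just y ∷ [])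
    g h with InC₁? (just y)
    ... | yes i = plain (λ { (inj₁ i') → ¬icq i' ; (inj₂ (below-here ¬i _)) → ¬i i ; (inj₂ (below-there _ ())) })
                        (final (inj₁ i) [])
    ... | no ¬i = final (inj₂ (below-here ¬i (h ¬i))) ([] ∷ [])

  DescentForm-length : ∀ {d xs} → DescentForm d xs → d ≤ length xs
  DescentForm-length (final _ _) = s≤s z≤n
  DescentForm-length (descent _ sp) = s≤s (DescentForm-length sp)
  DescentForm-length (plain _ sp) = ≤-trans (DescentForm-length sp) (n≤1+n _)

  HasOutsideC₁ : List Ext → Set
  HasOutsideC₁ = Any (λ x → ¬ InC₁ x)

  NextBelow⇒HasOutsideC₁ : ∀ {x ys} → NextBelow x ys → HasOutsideC₁ ys
  NextBelow⇒HasOutsideC₁ (below-here ¬i _) = here ¬i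
  NextBelow⇒HasOutsideC₁ (below-there _ n) = there (NextBelow⇒HasOutsideC₁ n)

  DescentForm-length-strict : ∀ {d xs} → DescentForm d xs → HasOutsideC₁ xs → d < length xs
  DescentForm-length-strict (final (inj₁ ic) _) (here ¬ic) = ⊥-elim (¬ic ic)
  DescentForm-length-strict {xs = x ∷ []} (final (inj₁ ic) _) (there ())
  DescentForm-length-strict {xs = x ∷ y ∷ ys} (final (inj₁ ic) _) (there h) = s≤s (s≤s z≤n)
  DescentForm-length-strict (final (inj₂ n) _) h with NextBelow⇒HasOutsideC₁ n
  ... | here _ = s≤s (s≤s z≤n)
  ... | there _ = s≤s (s≤s z≤n)
  DescentForm-length-strict (descent (inj₁ ic) sp) (here ¬ic) = ⊥-elim (¬ic ic)
  DescentForm-length-strict (descent (inj₁ ic) sp) (there h) = s≤s (DescentForm-length-strict sp h)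
  DescentForm-length-strict (descent (inj₂ n) sp) h = s≤s (DescentForm-length-strict sp (NextBelow⇒HasOutsideC₁ n))
  DescentForm-length-strict (plain _ sp) h = s≤s (DescentForm-length sp)

  -- With no room to spare, every entry outside C₁ must be a descent target of p.
  DescentForm-tight⇒below : ∀ w {d p} → DescentForm d (p ∷ embed w) → ¬ InC₁ p → length w ≡ d →
    ∀ x → x ∈ w → ¬ InC₁ (just x) → just x ≺ p
  DescentForm-tight⇒below [] sp ¬icp len x () ¬ic
  DescentForm-tight⇒below (s ∷ []) (final (inj₁ i) _) ¬icp len x m ¬ic = ⊥-elim (¬icp i)
  DescentForm-tight⇒below (s ∷ []) (final (inj₂ (below-here _ lt)) _) ¬icp len .s (here refl) ¬ic = lt
  DescentForm-tight⇒below (s ∷ []) (final (inj₂ (below-there i _)) _) ¬icp len .s (here refl) ¬ic = ⊥-elim (¬ic i)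
  DescentForm-tight⇒below (s ∷ []) (final _ _) ¬icp len x (there ()) ¬ic
  DescentForm-tight⇒below (s ∷ []) (descent _ sp) ¬icp ()
  DescentForm-tight⇒below (s ∷ []) (plain ¬dp sp) ¬icp refl x m ¬ic =
    ⊥-elim (<-irrefl refl (DescentForm-length-strict sp (Any.map (λ { refl → ¬ic }) (∈-map⁺ just m))))
  DescentForm-tight⇒below (s ∷ y ∷ w) {zero} sp ¬icp ()
  DescentForm-tight⇒below (s ∷ y ∷ w) {suc zero} sp ¬icp ()
  DescentForm-tight⇒below (s ∷ y ∷ w) {suc (suc d)} {p} sp ¬icp len x m ¬ic = go (InC₁? (just s)) sp m
    where
    go : Dec (InC₁ (just s)) → DescentForm (suc (suc d)) (p ∷ embed (s ∷ y ∷ w)) → x ∈ s ∷ y ∷ w → just x ≺ p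
    go (yes ics) sp (here refl) = ⊥-elim (¬ic ics)
    go (yes ics) sp (there m') =
      DescentForm-tight⇒below (y ∷ w) (to (DescentForm-skip-C₁ ¬icp ics) sp) ¬icp (suc-injective len) x m' ¬ic
    go (no ¬ics) (plain ¬dp sp) m =
      ⊥-elim (<-irrefl (sym len) (subst (suc (suc d) <_) (cong (λ z → suc (suc z)) (length-map just w))
                                   (DescentForm-length-strict sp (here ¬ics))))
    go (no ¬ics) (descent (inj₁ i) sp) m = ⊥-elim (¬icp i)
    go (no ¬ics) (descent (inj₂ (below-there i _)) sp) m = ⊥-elim (¬ics i)
    go (no ¬ics) (descent (inj₂ (below-here _ lt)) sp) (here refl) = lt
    go (no ¬ics) (descent (inj₂ (below-here _ lt)) sp) (there m') =
      ≺-trans (DescentForm-tight⇒below (y ∷ w) sp ¬ics (suc-injective len) x m' ¬ic) lt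

  Increasing⇒NextBelow : ∀ {p} w x → Increasing (embed w) → x ∈ w → ¬ InC₁ (just x) → just x ≺ p
      → NextBelow p (embed w)
  Increasing⇒NextBelow (y ∷ w) x (a ∷ inc) m ¬icx lt with InC₁? (just y)
  ... | yes icy with m
  ...   | here refl = ⊥-elim (¬icx icy)
  ...   | there m' = below-there icy (Increasing⇒NextBelow w x inc m' ¬icx lt)
  Increasing⇒NextBelow (y ∷ w) x (a ∷ inc) m ¬icx lt | no ¬icy with m
  ...   | here refl = below-here ¬icy lt
  ...   | there m' = below-here ¬icy (≺-trans (All-embed⁻ a x m') lt)


afterThreeLow : ℕ → ℕ → ℕ → ℕ → List ℕ → Set
afterThreeLow θ1 θ2 zero b w = Run (adjacent θ2 b) w
afterThreeLow θ1 θ2 (suc a) b w = Run (three θ1 θ2 a b) w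

afterThreeMid : ℕ → ℕ → ℕ → ℕ → List ℕ → Set
afterThreeMid θ1 s zero b w = Run (adjacent s b) w
afterThreeMid θ1 s (suc a) b w = Run (three θ1 s a b) w

afterThreeHigh : ℕ → ℕ → ℕ → ℕ → ℕ → List ℕ → Set
afterThreeHigh θ1 θ2 s a zero w = UpperBoundFrom θ2 s w × Run (apart θ1 a) w
afterThreeHigh θ1 θ2 s a (suc b) w = Run (three θ1 s a b) w

three-inv : ∀ {θ1 θ2 a b s w} → Run (three θ1 θ2 a b) (s ∷ w) →
  (s < θ1 × LowerBoundBelow θ1 s w × afterThreeLow θ1 θ2 a b w)
    ⊎ (θ1 ≤ s × s < θ2 × afterThreeMid θ1 s a b w) ⊎ (θ2 ≤ s × afterThreeHigh θ1 θ2 s a b w)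
three-inv (three-low x lo r) = inj₁ (x , lo , r)
three-inv (three-low₀ x lo r) = inj₁ (x , lo , r)
three-inv (three-mid x y r) = inj₂ (inj₁ (x , y , r))
three-inv (three-mid₀ x y r) = inj₂ (inj₁ (x , y , r))
three-inv (three-high x r) = inj₂ (inj₂ (x , r))
three-inv (three-high₀ x hi r) = inj₂ (inj₂ (x , hi , r))

three-intro : ∀ {θ1 θ2} a b {s w} →
  (s < θ1 × LowerBoundBelow θ1 s w × afterThreeLow θ1 θ2 a b w)
    ⊎ (θ1 ≤ s × s < θ2 × afterThreeMid θ1 s a b w) ⊎ (θ2 ≤ s × afterThreeHigh θ1 θ2 s a b w) →
  Run (three θ1 θ2 a b) (s ∷ w)
three-intro zero b (inj₁ (x , lo , r)) = three-low₀ x lo r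
three-intro (suc a) b (inj₁ (x , lo , r)) = three-low x lo r
three-intro zero b (inj₂ (inj₁ (x , y , r))) = three-mid₀ x y r
three-intro (suc a) b (inj₂ (inj₁ (x , y , r))) = three-mid x y r
three-intro a zero (inj₂ (inj₂ (x , hi , r))) = three-high₀ x hi r
three-intro a (suc b) (inj₂ (inj₂ (x , r))) = three-high x r

afterApart : ℕ → ℕ → List ℕ → Set
afterApart θ zero w = Run (one 0) w
afterApart θ (suc a) w = Run (apart θ a) w

apart-inv : ∀ {θ a s w} → Run (apart θ a) (s ∷ w) →
  (s < θ × LowerBoundBelow θ s w × afterApart θ a w) ⊎ (θ ≤ s × UpperBoundFrom θ s w × afterApart θ a w)
apart-inv (apart-low x lo r) = inj₁ (x , lo , r)
apart-inv (apart-low₀ x lo r) = inj₁ (x , lo , r)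
apart-inv (apart-high x hi r) = inj₂ (x , hi , r)
apart-inv (apart-high₀ x hi r) = inj₂ (x , hi , r)

apart-intro : ∀ {θ} a {s w} →
  (s < θ × LowerBoundBelow θ s w × afterApart θ a w) ⊎ (θ ≤ s × UpperBoundFrom θ s w × afterApart θ a w)
    → Run (apart θ a) (s ∷ w)
apart-intro zero (inj₁ (x , lo , r)) = apart-low₀ x lo r
apart-intro (suc a) (inj₁ (x , lo , r)) = apart-low x lo r
apart-intro zero (inj₂ (x , hi , r)) = apart-high₀ x hi r
apart-intro (suc a) (inj₂ (x , hi , r)) = apart-high x hi r

afterAdjacentHigh : ℕ → ℕ → ℕ → List ℕ → Set
afterAdjacentHigh θ s zero w = UpperBoundFrom θ s w × Run (one 0) w
afterAdjacentHigh θ s (suc b) w = Run (adjacent s b) w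

adjacent-inv : ∀ {θ b s w} → Run (adjacent θ b) (s ∷ w) →
  (s < θ × LowerBoundBelow θ s w × Run (one b) w) ⊎ (θ ≤ s × afterAdjacentHigh θ s b w)
adjacent-inv (adjacent-low x lo r) = inj₁ (x , lo , r)
adjacent-inv (adjacent-high x r) = inj₂ (x , r)
adjacent-inv (adjacent-high₀ x hi r) = inj₂ (x , hi , r)

adjacent-intro : ∀ {θ} b {s w} →
  (s < θ × LowerBoundBelow θ s w × Run (one b) w) ⊎ (θ ≤ s × afterAdjacentHigh θ s b w) → Run (adjacent θ b) (s ∷ w)
adjacent-intro b (inj₁ (x , lo , r)) = adjacent-low x lo r
adjacent-intro (suc b) (inj₂ (x , r)) = adjacent-high x r
adjacent-intro zero (inj₂ (x , hi , r)) = adjacent-high₀ x hi r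

module ThreeRuns (c t : ℕ) (c≤t : c ≤ t) where
  open Descents c t

  -- The upper threshold θ₂ of a shape is the value of the last deleted element p outside C₁.
  value : Ext → ℕ
  value nothing = t
  value (just v) = v

  OutsideC₁ : Ext → Set
  OutsideC₁ nothing = ⊤
  OutsideC₁ (just v) = c ≤ v

  IncreasingOnC₁ : List ℕ → Set
  IncreasingOnC₁ = AllPairs (λ x y → x < c → y < c → x < y)

  OutsideC₁Below : Ext → List ℕ → Set
  OutsideC₁Below p w = ∀ x → x ∈ w → c ≤ x → just x ≺ p

  Conds : ℕ → Ext → List ℕ → Set
  Conds d p w = IncreasingOnC₁ w × DescentForm d (p ∷ embed w)

  OutsideC₁⇒¬InC₁ : ∀ {p} → OutsideC₁ p → ¬ InC₁ p
  OutsideC₁⇒¬InC₁ {nothing} _ ()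
  OutsideC₁⇒¬InC₁ {just v} le lt = <⇒≱ lt le

  ≥c⇒¬InC₁ : ∀ {x} → c ≤ x → ¬ InC₁ (just x)
  ≥c⇒¬InC₁ le lt = <⇒≱ lt le

  ≺-value⁺ : ∀ {s} p → s < value p → just s ≺ p
  ≺-value⁺ nothing l = l
  ≺-value⁺ (just v) l = l

  ≺-value⁻ : ∀ {s} p → just s ≺ p → s < value p
  ≺-value⁻ nothing l = l
  ≺-value⁻ (just v) l = l

  c≤value : ∀ {p} → OutsideC₁ p → c ≤ value p
  c≤value {nothing} _ = c≤t
  c≤value {just v} le = le

  LowerBound⇒All≺ : ∀ {s w} → s ∉ w → LowerBound s w → All (just s ≺_) (embed w)
  LowerBound⇒All≺ nd lo = All-embed⁺ (λ x m → ≤∧≢⇒< (lo x m) (≢-sym (∉⇒≢ nd m)))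

  LowerBoundBelow⇒All≺ : ∀ {θ s w} → s < θ → s ∉ w → LowerBoundBelow θ s w → All (just s ≺_) (embed w)
  LowerBoundBelow⇒All≺ {θ} {s} {w} s<θ nd lo = All-embed⁺ s<
    where
    s< : ∀ x → x ∈ w → s < x
    s< x m with x <? θ
    ... | yes x<θ = ≤∧≢⇒< (lo x m x<θ) (≢-sym (∉⇒≢ nd m))
    ... | no ¬x<θ = <-≤-trans s<θ (≮⇒≥ ¬x<θ)

  Increasing⇒IncreasingOnC₁ : ∀ w → Increasing (embed w) → IncreasingOnC₁ w
  Increasing⇒IncreasingOnC₁ [] _ = []
  Increasing⇒IncreasingOnC₁ (s ∷ w) (a ∷ inc) = All.tabulate (λ {x} m _ _ → All-embed⁻ a x m)
      ∷ Increasing⇒IncreasingOnC₁ w inc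

  IncreasingOnC₁-∷-C₁ : ∀ {s w} → s < c → s ∉ w → IncreasingOnC₁ (s ∷ w)
      ⇔ (LowerBoundBelow c s w × IncreasingOnC₁ w)
  IncreasingOnC₁-∷-C₁ {s} {w} s<c nd = mk⇔
    (λ { (h ∷ ac) → (λ x m x<c → <⇒≤ (All.lookup h m s<c x<c)) , ac })
    (λ { (lo , ac) → All.tabulate (λ {x} m _ x<c → ≤∧≢⇒< (lo x m x<c) (≢-sym (∉⇒≢ nd m))) ∷ ac })

  IncreasingOnC₁-∷-outside : ∀ {s w} → ¬ s < c → IncreasingOnC₁ (s ∷ w) ⇔ IncreasingOnC₁ w
  IncreasingOnC₁-∷-outside ¬s<c = mk⇔ (λ { (h ∷ ac) → ac }) (λ ac → All.tabulate (λ _ s<c _ → ⊥-elim (¬s<c s<c)) ∷ ac)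

  one⇔Increasing : ∀ b w → Distinct w → Run (one b) w ⇔ Increasing (embed w)
  one⇔Increasing b [] dw = mk⇔ (λ _ → []) (λ _ → done)
  one⇔Increasing b (s ∷ w) (nd , dw) = mk⇔ (f b) (g b)
    where
    f : ∀ b → Run (one b) (s ∷ w) → Increasing (embed (s ∷ w))
    f (suc b) (one-min lo r) = LowerBound⇒All≺ nd lo ∷ to (one⇔Increasing b w dw) r
    f zero (one-min₀ lo r) = LowerBound⇒All≺ nd lo ∷ to (one⇔Increasing 0 w dw) r
    g : ∀ b → Increasing (embed (s ∷ w)) → Run (one b) (s ∷ w)
    g (suc b) (a ∷ inc) = one-min (λ x m → <⇒≤ (All-embed⁻ a x m)) (from (one⇔Increasing b w dw) inc)
    g zero (a ∷ inc) = one-min₀ (λ x m → <⇒≤ (All-embed⁻ a x m)) (from (one⇔Increasing 0 w dw) inc)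

  one-singleton : ∀ {y} → Run (one 0) (y ∷ [])
  one-singleton = one-min₀ (λ _ ()) done

  apart-low⇔ : ∀ {a s w p} → s < c → s ∉ w → OutsideC₁ p → afterApart c a w ⇔ Conds (suc a) p w →
    Run (apart c a) (s ∷ w) ⇔ Conds (suc (suc a)) p (s ∷ w)
  apart-low⇔ {a} {s} {w} {p} s<c nd ncp rest = mk⇔ f g
    where
    skip = DescentForm-skip-C₁ (OutsideC₁⇒¬InC₁ ncp) s<c
    f : Run (apart c a) (s ∷ w) → Conds (suc (suc a)) p (s ∷ w)
    f r with apart-inv r
    ... | inj₂ (c≤s , _) = ⊥-elim (<⇒≱ s<c c≤s)
    ... | inj₁ (_ , lo , rl) = let (acw , sp) = to rest rl in from (IncreasingOnC₁-∷-C₁ s<c nd) (lo , acw) , from skip sp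
    g : Conds (suc (suc a)) p (s ∷ w) → Run (apart c a) (s ∷ w)
    g (ac , sp) = let (lo , acw) = to (IncreasingOnC₁-∷-C₁ s<c nd) ac in
      apart-intro a (inj₁ (s<c , lo , from rest (acw , to skip sp)))

  apart-high⇔ : ∀ {a s w p} → c ≤ s → s ∉ w → length w ≡ suc a → just s ≺ p →
    (OutsideC₁Below (just s) w → afterApart c a w ⇔ Conds (suc a) (just s) w) →
    Run (apart c a) (s ∷ w) ⇔ Conds (suc (suc a)) p (s ∷ w)
  apart-high⇔ {a} {s} {w} {p} c≤s nd len lt rest = mk⇔ f g
    where
    ¬s<c = ≥c⇒¬InC₁ c≤s
    f : Run (apart c a) (s ∷ w) → Conds (suc (suc a)) p (s ∷ w)
    f r with apart-inv r
    ... | inj₁ (s<c , _) = ⊥-elim (¬s<c s<c)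
    ... | inj₂ (_ , hi , rl) =
      let (acw , sp) = to (rest (λ x m c≤x → ≤∧≢⇒< (hi x m c≤x) (∉⇒≢ nd m))) rl in
      from (IncreasingOnC₁-∷-outside ¬s<c) acw , from (DescentForm-descent ¬s<c lt) sp
    g : Conds (suc (suc a)) p (s ∷ w) → Run (apart c a) (s ∷ w)
    g (ac , sp) = apart-intro a (inj₂ (c≤s , (λ x m c≤x → <⇒≤ (below-s x m c≤x)) ,
                                  from (rest below-s) (to (IncreasingOnC₁-∷-outside ¬s<c) ac , sp')))
      where
      sp' = to (DescentForm-descent ¬s<c lt) sp
      below-s : OutsideC₁Below (just s) w
      below-s x m c≤x = DescentForm-tight⇒below w sp' ¬s<c len x m (≥c⇒¬InC₁ c≤x)

  mutual
    afterApart⇔ : ∀ a w q → OutsideC₁ q → Distinct w → length w ≡ suc a → OutsideC₁Below q w →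
      afterApart c a w ⇔ Conds (suc a) q w
    afterApart⇔ zero [] q ncq dw () inv
    afterApart⇔ zero (y ∷ []) q ncq dw refl inv = mk⇔
      (λ _ → ([] ∷ []) , from (DescentForm-pair (OutsideC₁⇒¬InC₁ ncq)) (λ ¬ic → inv y (here refl) (≮⇒≥ ¬ic)))
      (λ _ → one-singleton)
    afterApart⇔ zero (y ∷ z ∷ w) q ncq dw () inv
    afterApart⇔ (suc a) w q ncq dw len inv = apart⇔ w a q ncq dw len inv

    apart⇔ : ∀ w a p → OutsideC₁ p → Distinct w → length w ≡ suc (suc a) → OutsideC₁Below p w →
      Run (apart c a) w ⇔ Conds (suc (suc a)) p w
    apart⇔ [] a p ncp dw () inv
    apart⇔ (s ∷ w) a p ncp (nd , dw) len inv with s <? c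
    ... | yes s<c = apart-low⇔ s<c nd ncp (afterApart⇔ a w p ncp dw (suc-injective len) (λ x m → inv x (there m)))
    ... | no ¬s<c = apart-high⇔ c≤s nd (suc-injective len) (inv s (here refl) c≤s)
                                 (afterApart⇔ a w (just s) c≤s dw (suc-injective len))
      where c≤s = ≮⇒≥ ¬s<c

  adjacent-low⇔ : ∀ {b s w p} → s < c → s ∉ w → Distinct w → OutsideC₁ p →
    Run (adjacent (value p) b) (s ∷ w) ⇔ Conds 1 p (s ∷ w)
  adjacent-low⇔ {b} {s} {w} {p} s<c nd dw ncp = mk⇔ f g
    where
    ¬icp = OutsideC₁⇒¬InC₁ ncp
    s<θ = <-≤-trans s<c (c≤value ncp)
    f : Run (adjacent (value p) b) (s ∷ w) → Conds 1 p (s ∷ w)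
    f r with adjacent-inv r
    ... | inj₂ (θ≤s , _) = ⊥-elim (<⇒≱ s<θ θ≤s)
    ... | inj₁ (_ , lo , ri) =
      from (IncreasingOnC₁-∷-C₁ s<c nd) ((λ x m x<c → lo x m (<-≤-trans x<c (c≤value ncp)))
          , Increasing⇒IncreasingOnC₁ w inc) ,
      form (NextBelow? p (embed w))
      where
      inc = to (one⇔Increasing b w dw) ri
      form : Dec (NextBelow p (embed w)) → DescentForm 1 (p ∷ just s ∷ embed w)
      form (yes n) = final (inj₂ (below-there s<c n)) (LowerBoundBelow⇒All≺ s<θ nd lo ∷ inc)
      form (no ¬n) = plain (λ { (inj₁ i) → ¬icp i ; (inj₂ (below-here ¬i _)) → ¬i s<c ; (inj₂ (below-there _ n)) → ¬n n })
                           (final (inj₁ s<c) inc)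
    g : Conds 1 p (s ∷ w) → Run (adjacent (value p) b) (s ∷ w)
    g (ac , sp) with to (IncreasingOnC₁-∷-C₁ s<c nd) ac | sp
    ... | _ | final _ (a ∷ inc) = adjacent-low s<θ (λ x m _ → <⇒≤ (All-embed⁻ a x m)) (from (one⇔Increasing b w dw) inc)
    ... | loc , _ | plain ¬dp (final _ inc) = adjacent-low s<θ lo (from (one⇔Increasing b w dw) inc)
      where
      -- an element of w below value p but outside C₁ would make s a C₁-descent
      lo : LowerBoundBelow (value p) s w
      lo x m x<θ with x <? c
      ... | yes x<c = loc x m x<c
      ... | no ¬x<c = ⊥-elim (¬dp (inj₂ (below-there s<c (Increasing⇒NextBelow w x inc m ¬x<c (≺-value⁺ p x<θ)))))
    ... | _ | plain ¬dp (plain ¬ds _) = ⊥-elim (¬ds (inj₁ s<c))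

  adjacent-mid⇔ : ∀ {b s w p} → c ≤ s → s < value p → s ∉ w → Distinct w →
    Run (adjacent (value p) b) (s ∷ w) ⇔ Conds 1 p (s ∷ w)
  adjacent-mid⇔ {b} {s} {w} {p} c≤s s<θ nd dw = mk⇔ f g
    where
    ¬s<c = ≥c⇒¬InC₁ c≤s
    lt = ≺-value⁺ p s<θ
    f : Run (adjacent (value p) b) (s ∷ w) → Conds 1 p (s ∷ w)
    f r with adjacent-inv r
    ... | inj₂ (θ≤s , _) = ⊥-elim (<⇒≱ s<θ θ≤s)
    ... | inj₁ (_ , lo , ri) =
      let inc = to (one⇔Increasing b w dw) ri in
      from (IncreasingOnC₁-∷-outside ¬s<c) (Increasing⇒IncreasingOnC₁ w inc) ,
      from (DescentForm-final ¬s<c lt) (LowerBoundBelow⇒All≺ s<θ nd lo ∷ inc)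
    g : Conds 1 p (s ∷ w) → Run (adjacent (value p) b) (s ∷ w)
    g (ac , sp) with to (DescentForm-final ¬s<c lt) sp
    ... | a ∷ inc = adjacent-low s<θ (λ x m _ → <⇒≤ (All-embed⁻ a x m)) (from (one⇔Increasing b w dw) inc)

  adjacent-high⇔ : ∀ {b s w p} → value p ≤ s → OutsideC₁ p →
    afterAdjacentHigh (value p) s b w ⇔ Conds 1 (just s) w →
    Run (adjacent (value p) b) (s ∷ w) ⇔ Conds 1 p (s ∷ w)
  adjacent-high⇔ {b} {s} {w} {p} θ≤s ncp rest = mk⇔ f g
    where
    ¬s<c = ≥c⇒¬InC₁ (≤-trans (c≤value ncp) θ≤s)
    plain⇔ = DescentForm-plain {0} {p} {just s} {embed w} (OutsideC₁⇒¬InC₁ ncp) ¬s<c (λ l → <⇒≱ (≺-value⁻ p l) θ≤s)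
    f : Run (adjacent (value p) b) (s ∷ w) → Conds 1 p (s ∷ w)
    f r with adjacent-inv r
    ... | inj₁ (s<θ , _) = ⊥-elim (<⇒≱ s<θ θ≤s)
    ... | inj₂ (_ , x) = let (acw , sp) = to rest x in from (IncreasingOnC₁-∷-outside ¬s<c) acw , from plain⇔ sp
    g : Conds 1 p (s ∷ w) → Run (adjacent (value p) b) (s ∷ w)
    g (ac , sp) = adjacent-intro b (inj₂ (θ≤s , from rest (to (IncreasingOnC₁-∷-outside ¬s<c) ac , to plain⇔ sp)))

  afterAdjacentHigh-singleton⇔ : ∀ {p s y} → OutsideC₁ p → c ≤ s → value p ≤ s → s ∉ y ∷ [] →
    afterAdjacentHigh (value p) s 0 (y ∷ []) ⇔ Conds 1 (just s) (y ∷ [])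
  afterAdjacentHigh-singleton⇔ {p} {s} {y} ncp c≤s θ≤s nd = mk⇔ f g
    where
    pair = DescentForm-pair (≥c⇒¬InC₁ c≤s)
    f : afterAdjacentHigh (value p) s 0 (y ∷ []) → Conds 1 (just s) (y ∷ [])
    f (hi , _) = ([] ∷ []) , from pair y<s
      where
      y<s : ¬ InC₁ (just y) → y < s
      y<s _ with y <? value p
      ... | yes y<θ = <-≤-trans y<θ θ≤s
      ... | no ¬y<θ = ≤∧≢⇒< (hi y (here refl) (≮⇒≥ ¬y<θ)) (∉⇒≢ nd (here refl))
    g : Conds 1 (just s) (y ∷ []) → afterAdjacentHigh (value p) s 0 (y ∷ [])
    g (_ , sp) = hi , one-singleton
      where
      hi : UpperBoundFrom (value p) s (y ∷ [])
      hi x (here refl) θ≤x = <⇒≤ (to pair sp (≥c⇒¬InC₁ (≤-trans (c≤value ncp) θ≤x)))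

  mutual
    afterAdjacentHigh⇔ : ∀ b w p s → OutsideC₁ p → c ≤ s → value p ≤ s → Distinct w → s ∉ w → length w ≡ suc b →
      afterAdjacentHigh (value p) s b w ⇔ Conds 1 (just s) w
    afterAdjacentHigh⇔ zero [] p s ncp c≤s θ≤s dw nd ()
    afterAdjacentHigh⇔ zero (y ∷ []) p s ncp c≤s θ≤s dw nd refl = afterAdjacentHigh-singleton⇔ ncp c≤s θ≤s nd
    afterAdjacentHigh⇔ zero (y ∷ z ∷ w) p s ncp c≤s θ≤s dw nd ()
    afterAdjacentHigh⇔ (suc b) w p s ncp c≤s θ≤s dw nd len = adjacent⇔ w b (just s) c≤s dw len

    adjacent⇔ : ∀ w b p → OutsideC₁ p → Distinct w → length w ≡ suc (suc b) →
      Run (adjacent (value p) b) w ⇔ Conds 1 p w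
    adjacent⇔ [] b p ncp dw ()
    adjacent⇔ (s ∷ w) b p ncp (nd , dw) len with s <? c | s <? value p
    ... | yes s<c | _ = adjacent-low⇔ s<c nd dw ncp
    ... | no ¬s<c | yes s<θ = adjacent-mid⇔ (≮⇒≥ ¬s<c) s<θ nd dw
    ... | no ¬s<c | no ¬s<θ = adjacent-high⇔ θ≤s ncp
        (afterAdjacentHigh⇔ b w p s ncp (≮⇒≥ ¬s<c) θ≤s dw nd (suc-injective len))
      where θ≤s = ≮⇒≥ ¬s<θ

  three-low⇔ : ∀ {a b s w p} → s < c → s ∉ w → OutsideC₁ p →
    afterThreeLow c (value p) a b w ⇔ Conds (suc a) p w →
    Run (three c (value p) a b) (s ∷ w) ⇔ Conds (suc (suc a)) p (s ∷ w)
  three-low⇔ {a} {b} {s} {w} {p} s<c nd ncp rest = mk⇔ f g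
    where
    skip = DescentForm-skip-C₁ (OutsideC₁⇒¬InC₁ ncp) s<c
    f : Run (three c (value p) a b) (s ∷ w) → Conds (suc (suc a)) p (s ∷ w)
    f r with three-inv r
    ... | inj₁ (_ , lo , ra) = let (acw , sp) = to rest ra in from (IncreasingOnC₁-∷-C₁ s<c nd) (lo , acw) , from skip sp
    ... | inj₂ (inj₁ (c≤s , _)) = ⊥-elim (<⇒≱ s<c c≤s)
    ... | inj₂ (inj₂ (θ≤s , _)) = ⊥-elim (<⇒≱ s<c (≤-trans (c≤value ncp) θ≤s))
    g : Conds (suc (suc a)) p (s ∷ w) → Run (three c (value p) a b) (s ∷ w)
    g (ac , sp) = let (lo , acw) = to (IncreasingOnC₁-∷-C₁ s<c nd) ac in
      three-intro a b (inj₁ (s<c , lo , from rest (acw , to skip sp)))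

  three-mid⇔ : ∀ {a b s w p} → c ≤ s → s < value p →
    afterThreeMid c s a b w ⇔ Conds (suc a) (just s) w →
    Run (three c (value p) a b) (s ∷ w) ⇔ Conds (suc (suc a)) p (s ∷ w)
  three-mid⇔ {a} {b} {s} {w} {p} c≤s s<θ rest = mk⇔ f g
    where
    ¬s<c = ≥c⇒¬InC₁ c≤s
    descent⇔ = DescentForm-descent {a} ¬s<c (≺-value⁺ p s<θ)
    f : Run (three c (value p) a b) (s ∷ w) → Conds (suc (suc a)) p (s ∷ w)
    f r with three-inv r
    ... | inj₁ (s<c , _) = ⊥-elim (¬s<c s<c)
    ... | inj₂ (inj₁ (_ , _ , rb)) = let (acw , sp) = to rest rb in from (IncreasingOnC₁-∷-outside ¬s<c) acw , from descent⇔ sp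
    ... | inj₂ (inj₂ (θ≤s , _)) = ⊥-elim (<⇒≱ s<θ θ≤s)
    g : Conds (suc (suc a)) p (s ∷ w) → Run (three c (value p) a b) (s ∷ w)
    g (ac , sp) = three-intro a b
        (inj₂ (inj₁ (c≤s , s<θ , from rest (to (IncreasingOnC₁-∷-outside ¬s<c) ac , to descent⇔ sp))))

  three-high⇔ : ∀ {a b s w p} → value p ≤ s → OutsideC₁ p →
    afterThreeHigh c (value p) s a b w ⇔ Conds (suc (suc a)) (just s) w →
    Run (three c (value p) a b) (s ∷ w) ⇔ Conds (suc (suc a)) p (s ∷ w)
  three-high⇔ {a} {b} {s} {w} {p} θ≤s ncp rest = mk⇔ f g
    where
    ¬s<c = ≥c⇒¬InC₁ (≤-trans (c≤value ncp) θ≤s)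
    plain⇔ = DescentForm-plain {suc a} {p} {just s} {embed w} (OutsideC₁⇒¬InC₁ ncp) ¬s<c (λ l → <⇒≱ (≺-value⁻ p l) θ≤s)
    f : Run (three c (value p) a b) (s ∷ w) → Conds (suc (suc a)) p (s ∷ w)
    f r with three-inv r
    ... | inj₁ (s<c , _) = ⊥-elim (¬s<c s<c)
    ... | inj₂ (inj₁ (_ , s<θ , _)) = ⊥-elim (<⇒≱ s<θ θ≤s)
    ... | inj₂ (inj₂ (_ , rc)) = let (acw , sp) = to rest rc in from (IncreasingOnC₁-∷-outside ¬s<c) acw , from plain⇔ sp
    g : Conds (suc (suc a)) p (s ∷ w) → Run (three c (value p) a b) (s ∷ w)
    g (ac , sp) = three-intro a b (inj₂ (inj₂ (θ≤s , from rest (to (IncreasingOnC₁-∷-outside ¬s<c) ac , to plain⇔ sp))))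

  afterThreeHigh₀⇔ : ∀ {a w p s} → OutsideC₁ p → value p ≤ s → Distinct w → s ∉ w → length w ≡ suc (suc a) →
    afterThreeHigh c (value p) s a 0 w ⇔ Conds (suc (suc a)) (just s) w
  afterThreeHigh₀⇔ {a} {w} {p} {s} ncp θ≤s dw nd len = mk⇔ f g
    where
    c≤s = ≤-trans (c≤value ncp) θ≤s
    f : afterThreeHigh c (value p) s a 0 w → Conds (suc (suc a)) (just s) w
    f (hi , rl) = to (apart⇔ w a (just s) c≤s dw len below-s) rl
      where
      below-s : OutsideC₁Below (just s) w
      below-s x m c≤x with x <? value p
      ... | yes x<θ = <-≤-trans x<θ θ≤s
      ... | no ¬x<θ = ≤∧≢⇒< (hi x m (≮⇒≥ ¬x<θ)) (∉⇒≢ nd m)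
    g : Conds (suc (suc a)) (just s) w → afterThreeHigh c (value p) s a 0 w
    g (acw , sp) = (λ x m θ≤x → <⇒≤ (below-s x m (≤-trans (c≤value ncp) θ≤x))) ,
                   from (apart⇔ w a (just s) c≤s dw len below-s) (acw , sp)
      where
      below-s : OutsideC₁Below (just s) w
      below-s x m c≤x = DescentForm-tight⇒below w sp (≥c⇒¬InC₁ c≤s) len x m (≥c⇒¬InC₁ c≤x)

  three⇔ : ∀ w a b p → OutsideC₁ p → Distinct w → length w ≡ suc (suc (suc (a + b))) →
    Run (three c (value p) a b) w ⇔ Conds (suc (suc a)) p w
  three⇔ [] a b p ncp dw ()
  three⇔ (s ∷ w) a b p ncp (nd , dw) len = by-cases (s <? c) (s <? value p)
    where
    len' = suc-injective len
    afterLow : ∀ a → length w ≡ suc (suc (a + b)) → afterThreeLow c (value p) a b w ⇔ Conds (suc a) p w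
    afterLow zero l = adjacent⇔ w b p ncp dw l
    afterLow (suc a) l = three⇔ w a b p ncp dw l
    afterMid : ∀ a → c ≤ s → length w ≡ suc (suc (a + b)) → afterThreeMid c s a b w ⇔ Conds (suc a) (just s) w
    afterMid zero c≤s l = adjacent⇔ w b (just s) c≤s dw l
    afterMid (suc a) c≤s l = three⇔ w a b (just s) c≤s dw l
    afterHigh : ∀ b → value p ≤ s → length w ≡ suc (suc (a + b)) →
      afterThreeHigh c (value p) s a b w ⇔ Conds (suc (suc a)) (just s) w
    afterHigh zero θ≤s l = afterThreeHigh₀⇔ ncp θ≤s dw nd (trans l (cong (λ z → suc (suc z)) (+-identityʳ a)))
    afterHigh (suc b) θ≤s l =
      three⇔ w a b (just s) (≤-trans (c≤value ncp) θ≤s) dw (trans l (cong (λ z → suc (suc z)) (+-suc a b)))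
    by-cases : Dec (s < c) → Dec (s < value p) → Run (three c (value p) a b) (s ∷ w) ⇔ Conds (suc (suc a)) p (s ∷ w)
    by-cases (yes s<c) _ = three-low⇔ s<c nd ncp (afterLow a len')
    by-cases (no ¬s<c) (yes s<θ) = three-mid⇔ (≮⇒≥ ¬s<c) s<θ (afterMid a (≮⇒≥ ¬s<c) len')
    by-cases (no ¬s<c) (no ¬s<θ) = three-high⇔ (≮⇒≥ ¬s<θ) ncp (afterHigh b (≮⇒≥ ¬s<θ) len')


module IndexedDescents (c t : ℕ) where
  open import Data.Fin using (zero; suc)

  nonzero⇒suc : ∀ {n} (k : Fin (suc n)) → k ≢ zero → Σ (Fin n) λ j → k ≡ suc j
  nonzero⇒suc zero ne = ⊥-elim (ne refl)
  nonzero⇒suc (suc j) _ = j , refl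

  open Descents c t

  IsDescent : ∀ {L} → Vec Ext L → Fin L → Set
  IsDescent = IsC1Descent c t

  NextBelow⇔index : ∀ {n} y (xs : Vec Ext n) → NextBelow y (toList xs) ⇔
        Σ (Fin n) λ j → ¬ InC₁ (lookup xs j) × (lookup xs j ≺ y) × (∀ l → l <ᶠ j → InC₁ (lookup xs l))
  NextBelow⇔index y [] = mk⇔ (λ ()) (λ { (() , _) })
  NextBelow⇔index y (z ∷ zs) = mk⇔ f g
    where
    f : NextBelow y (z ∷ toList zs) → _
    f (below-here ¬ic lt) = zero , ¬ic , lt , (λ l ())
    f (below-there ic n) = let (j , ¬ic , lt , h) = to (NextBelow⇔index y zs) n in
      suc j , ¬ic , lt , λ { zero _ → ic ; (suc l) l<j → h l (s<s⁻¹ l<j) }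
    g : (Σ (Fin _) λ j → ¬ InC₁ (lookup (z ∷ zs) j) × (lookup (z ∷ zs) j ≺ y) × (∀ l → l <ᶠ j → InC₁ (lookup (z ∷ zs) l))) →
        NextBelow y (z ∷ toList zs)
    g (zero , ¬ic , lt , h) = below-here ¬ic lt
    g (suc j , ¬ic , lt , h) = below-there (h zero z<s)
        (from (NextBelow⇔index y zs) (j , ¬ic , lt , λ l l<j → h (suc l) (s≤s l<j)))

  IsDescent-zero : ∀ {n} y (xs : Vec Ext n) → IsDescent (y ∷ xs) zero ⇔ Descent y (toList xs)
  IsDescent-zero y xs = mk⇔ f g
    where
    f : IsDescent (y ∷ xs) zero → Descent y (toList xs)
    f (inj₁ ic) = inj₁ ic
    f (inj₂ (zero , () , _))
    f (inj₂ (suc j , _ , ¬ic , lt , h)) = inj₂ (from (NextBelow⇔index y xs) (j , ¬ic , lt , λ l l<j → h (suc l) z<s (s≤s l<j)))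
    g : Descent y (toList xs) → IsDescent (y ∷ xs) zero
    g (inj₁ ic) = inj₁ ic
    g (inj₂ n) = let (j , ¬ic , lt , h) = to (NextBelow⇔index y xs) n in
      inj₂ (suc j , z<s , ¬ic , lt , λ { zero () _ ; (suc l) _ l<j → h l (s<s⁻¹ l<j) })

  IsDescent-suc : ∀ {n} y (xs : Vec Ext n) i → IsDescent (y ∷ xs) (suc i) ⇔ IsDescent xs i
  IsDescent-suc y xs i = mk⇔ f g
    where
    f : IsDescent (y ∷ xs) (suc i) → IsDescent xs i
    f (inj₁ ic) = inj₁ ic
    f (inj₂ (zero , () , _))
    f (inj₂ (suc j , i<j , ¬ic , lt , h)) = inj₂ (j , s<s⁻¹ i<j , ¬ic , lt , λ l p q → h (suc l) (s≤s p) (s≤s q))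
    g : IsDescent xs i → IsDescent (y ∷ xs) (suc i)
    g (inj₁ ic) = inj₁ ic
    g (inj₂ (j , i<j , ¬ic , lt , h)) =
      inj₂ (suc j , s≤s i<j , ¬ic , lt , λ { zero () _ ; (suc l) p q → h l (s<s⁻¹ p) (s<s⁻¹ q) })

  AtLeast : ∀ {L} → ℕ → Vec Ext L → Set
  AtLeast d x = AtLeastDescents d c t x

  Exactly : ∀ {L} → ℕ → Vec Ext L → Fin L → Set
  Exactly e x i = ExactlyDescentsBefore e c t x i

  module Predecessor {d L} (f : Fin d → Fin (suc L)) (inj : ∀ {u v} → f u ≡ f v → u ≡ v) (nz : ∀ v → f v ≢ zero) where
    g : Fin d → Fin L
    g v = proj₁ (nonzero⇒suc (f v) (nz v))
    geq : ∀ v → f v ≡ suc (g v)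
    geq v = proj₂ (nonzero⇒suc (f v) (nz v))
    ginj : ∀ {v w} → g v ≡ g w → v ≡ w
    ginj {v} {w} e = inj (trans (geq v) (trans (cong suc e) (sym (geq w))))

  AtLeast-∷⁻ : ∀ {n d} y (xs : Vec Ext n) → AtLeast (suc d) (y ∷ xs) → AtLeast d xs
  AtLeast-∷⁻ {n} {d} y xs (f , inj , ds) = g , ginj ,
      λ v → to (IsDescent-suc y xs (g v)) (subst (IsDescent (y ∷ xs)) (geq v) (ds (punchIn u0 v)))
    where
    -- drop the witness of the descent at position 0, or any witness if there is none
    pick : Dec (∃ λ u → f u ≡ zero) → Σ (Fin (suc d)) λ u0 → ∀ v → f (punchIn u0 v) ≢ zero
    pick (yes (u0 , e)) = u0 , λ v e' → punchInᵢ≢i u0 v (inj (trans e' (sym e)))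
    pick (no ¬e) = zero , λ v e' → ¬e (_ , e')
    u0 = proj₁ (pick (any? (λ u → f u Fin.≟ zero)))
    open Predecessor (λ v → f (punchIn u0 v)) (λ e → punchIn-injective u0 _ _ (inj e))
        (proj₂ (pick (any? (λ u → f u Fin.≟ zero))))

  AtLeast-∷⁺ : ∀ {n d} y (xs : Vec Ext n) → Descent y (toList xs) → AtLeast d xs → AtLeast (suc d) (y ∷ xs)
  AtLeast-∷⁺ y xs dy (g , inj , ds) = f , finj , fds
    where
    f : Fin (suc _) → Fin (suc _)
    f zero = zero
    f (suc v) = suc (g v)
    finj : ∀ {u v} → f u ≡ f v → u ≡ v
    finj {zero} {zero} _ = refl
    finj {zero} {suc v} ()
    finj {suc u} {zero} ()
    finj {suc u} {suc v} e = cong suc (inj (fsuc-injective e))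
    fds : ∀ u → IsDescent (y ∷ xs) (f u)
    fds zero = from (IsDescent-zero y xs) dy
    fds (suc v) = from (IsDescent-suc y xs (g v)) (ds v)

  AtLeast-plain-∷⁻ : ∀ {n d} y (xs : Vec Ext n) → ¬ Descent y (toList xs) → AtLeast d (y ∷ xs) → AtLeast d xs
  AtLeast-plain-∷⁻ y xs ¬dy (f , inj , ds) = g , ginj ,
      λ v → to (IsDescent-suc y xs (g v)) (subst (IsDescent (y ∷ xs)) (geq v) (ds v))
    where
    nz : ∀ v → f v ≢ zero
    nz v e = ¬dy (to (IsDescent-zero y xs) (subst (IsDescent (y ∷ xs)) e (ds v)))
    open Predecessor f inj nz

  AtLeast-there : ∀ {n d} y (xs : Vec Ext n) → AtLeast d xs → AtLeast d (y ∷ xs)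
  AtLeast-there y xs (g , inj , ds) = (λ v → suc (g v)) ,
      (λ e → inj (fsuc-injective e)) , (λ v → from (IsDescent-suc y xs (g v)) (ds v))

  Exactly-∷⁻ : ∀ {n e} y (xs : Vec Ext n) i → Descent y (toList xs) → Exactly (suc e) (y ∷ xs) (suc i) → Exactly e xs i
  Exactly-∷⁻ y xs i dy (f , inj , dl , surj) = g , ginj , dl' , surj'
    where
    z0 = surj zero (from (IsDescent-zero y xs) dy) z<s
    u0 = proj₁ z0
    e0 = proj₂ z0
    nz : ∀ v → f (punchIn u0 v) ≢ zero
    nz v e' = punchInᵢ≢i u0 v (inj (trans e' (sym e0)))
    open Predecessor (λ v → f (punchIn u0 v)) (λ e → punchIn-injective u0 _ _ (inj e)) nz
    dl' : ∀ v → IsDescent xs (g v) × g v <ᶠ i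
    dl' v = to (IsDescent-suc y xs (g v)) (subst (IsDescent (y ∷ xs)) (geq v) (proj₁ (dl (punchIn u0 v)))) ,
            s<s⁻¹ (subst (_<ᶠ suc i) (geq v) (proj₂ (dl (punchIn u0 v))))
    surj' : ∀ j → IsDescent xs j → j <ᶠ i → ∃ λ v → g v ≡ j
    surj' j dj j<i with surj (suc j) (from (IsDescent-suc y xs j) dj) (s≤s j<i)
    ... | u , eu = v , fsuc-injective (trans (sym (geq v)) (trans (cong f pe) eu))
      where
      ne : u0 ≢ u
      ne e with trans (sym e0) (trans (cong f e) eu)
      ... | ()
      v = punchOut ne
      pe : punchIn u0 v ≡ u
      pe = punchIn-punchOut ne

  Exactly-∷⁺ : ∀ {n e} y (xs : Vec Ext n) i → Descent y (toList xs) → Exactly e xs i → Exactly (suc e) (y ∷ xs) (suc i)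
  Exactly-∷⁺ y xs i dy (g , inj , dl , surj) = f , finj , fdl , fsurj
    where
    f : Fin (suc _) → Fin (suc _)
    f zero = zero
    f (suc v) = suc (g v)
    finj : ∀ {u v} → f u ≡ f v → u ≡ v
    finj {zero} {zero} _ = refl
    finj {zero} {suc v} ()
    finj {suc u} {zero} ()
    finj {suc u} {suc v} e = cong suc (inj (fsuc-injective e))
    fdl : ∀ u → IsDescent (y ∷ xs) (f u) × f u <ᶠ suc i
    fdl zero = from (IsDescent-zero y xs) dy , z<s
    fdl (suc v) = from (IsDescent-suc y xs (g v)) (proj₁ (dl v)) , s≤s (proj₂ (dl v))
    fsurj : ∀ j → IsDescent (y ∷ xs) j → j <ᶠ suc i → ∃ λ u → f u ≡ j
    fsurj zero _ _ = zero , refl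
    fsurj (suc j) dj j<i with surj j (to (IsDescent-suc y xs j) dj) (s<s⁻¹ j<i)
    ... | u , e = suc u , cong suc e

  ¬Exactly-zero-after-descent : ∀ {n} y (xs : Vec Ext n) i → Descent y (toList xs) → ¬ Exactly 0 (y ∷ xs) (suc i)
  ¬Exactly-zero-after-descent y xs i dy (f , _ , _ , surj) with surj zero (from (IsDescent-zero y xs) dy) z<s
  ... | () , _

  Exactly-plain-∷⁻ : ∀ {n e} y (xs : Vec Ext n) i → ¬ Descent y (toList xs) → Exactly e (y ∷ xs) (suc i) → Exactly e xs i
  Exactly-plain-∷⁻ y xs i ¬dy (f , inj , dl , surj) = g , ginj , dl' , surj'
    where
    nz : ∀ v → f v ≢ zero
    nz v e = ¬dy (to (IsDescent-zero y xs) (subst (IsDescent (y ∷ xs)) e (proj₁ (dl v))))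
    open Predecessor f inj nz
    dl' : ∀ v → IsDescent xs (g v) × g v <ᶠ i
    dl' v = to (IsDescent-suc y xs (g v)) (subst (IsDescent (y ∷ xs)) (geq v) (proj₁ (dl v))) ,
            s<s⁻¹ (subst (_<ᶠ suc i) (geq v) (proj₂ (dl v)))
    surj' : ∀ j → IsDescent xs j → j <ᶠ i → ∃ λ v → g v ≡ j
    surj' j dj j<i with surj (suc j) (from (IsDescent-suc y xs j) dj) (s≤s j<i)
    ... | u , eu = u , fsuc-injective (trans (sym (geq u)) eu)

  Exactly-plain-∷⁺ : ∀ {n e} y (xs : Vec Ext n) i → ¬ Descent y (toList xs) → Exactly e xs i → Exactly e (y ∷ xs) (suc i)
  Exactly-plain-∷⁺ y xs i ¬dy (g , inj , dl , surj) =
    (λ v → suc (g v)) , (λ e → inj (fsuc-injective e)) ,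
    (λ v → from (IsDescent-suc y xs (g v)) (proj₁ (dl v)) , s≤s (proj₂ (dl v))) , fsurj
    where
    fsurj : ∀ j → IsDescent (y ∷ xs) j → j <ᶠ suc i → ∃ λ u → suc (g u) ≡ j
    fsurj zero dz _ = ⊥-elim (¬dy (to (IsDescent-zero y xs) dz))
    fsurj (suc j) dj j<i with surj j (to (IsDescent-suc y xs j) dj) (s<s⁻¹ j<i)
    ... | u , e = u , cong suc e

  Exactly-at-zero : ∀ {L e} (x : Vec Ext (suc L)) → Exactly e x zero → e ≡ 0
  Exactly-at-zero {e = zero} x _ = refl
  Exactly-at-zero {e = suc e} x (f , _ , dl , _) with proj₂ (dl zero)
  ... | ()

  Exactly-none : ∀ {L} (x : Vec Ext (suc L)) → Exactly 0 x zero
  Exactly-none x = (λ ()) , (λ {u} → ⊥-elim' u) , (λ ()) , (λ j _ ())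
    where
    ⊥-elim' : ∀ (u : Fin 0) {v} → _ → u ≡ v
    ⊥-elim' ()

  All-toList⁺ : ∀ {n} {P : Ext → Set} (xs : Vec Ext n) → (∀ q → P (lookup xs q)) → All P (toList xs)
  All-toList⁺ [] h = []
  All-toList⁺ (z ∷ zs) h = h zero ∷ All-toList⁺ zs (λ q → h (suc q))

  All-toList⁻ : ∀ {n} {P : Ext → Set} (xs : Vec Ext n) → All P (toList xs) → ∀ q → P (lookup xs q)
  All-toList⁻ (z ∷ zs) (p ∷ ps) zero = p
  All-toList⁻ (z ∷ zs) (p ∷ ps) (suc q) = All-toList⁻ zs ps q

  AllPairs-toList : ∀ {n} (R : Ext → Ext → Set) (xs : Vec Ext n) →
           (∀ p q → p <ᶠ q → R (lookup xs p) (lookup xs q)) ⇔ AllPairs R (toList xs)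
  AllPairs-toList R [] = mk⇔ (λ _ → []) (λ _ p → λ ())
  AllPairs-toList R (z ∷ zs) = mk⇔ f g
    where
    f : (∀ p q → p <ᶠ q → R (lookup (z ∷ zs) p) (lookup (z ∷ zs) q)) → AllPairs R (z ∷ toList zs)
    f h = All-toList⁺ zs (λ q → h zero (suc q) z<s) ∷ to (AllPairs-toList R zs) (λ p q p<q → h (suc p) (suc q) (s≤s p<q))
    g : AllPairs R (z ∷ toList zs) → ∀ p q → p <ᶠ q → R (lookup (z ∷ zs) p) (lookup (z ∷ zs) q)
    g (a ∷ ap) zero zero ()
    g (a ∷ ap) zero (suc q) _ = All-toList⁻ zs a q
    g (a ∷ ap) (suc p) zero ()
    g (a ∷ ap) (suc p) (suc q) p<q = from (AllPairs-toList R zs) ap p q (s<s⁻¹ p<q)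

  IncreasingAfter : ∀ {L} → Vec Ext L → Fin L → Set
  IncreasingAfter x i = ∀ p q → i <ᶠ p → p <ᶠ q → lookup x p ≺ lookup x q

  IncreasingAfter-suc : ∀ {n} y (xs : Vec Ext n) i → IncreasingAfter (y ∷ xs) (suc i) ⇔ IncreasingAfter xs i
  IncreasingAfter-suc y xs i = mk⇔ (λ h p q a b → h (suc p) (suc q) (s≤s a) (s≤s b)) g
    where
    g : IncreasingAfter xs i → IncreasingAfter (y ∷ xs) (suc i)
    g h zero q () _
    g h (suc p) zero _ ()
    g h (suc p) (suc q) a b = h p q (s<s⁻¹ a) (s<s⁻¹ b)

  IncreasingAfter-zero : ∀ {n} y (xs : Vec Ext n) → IncreasingAfter (y ∷ xs) zero ⇔ Increasing (toList xs)
  IncreasingAfter-zero y xs = mk⇔ (λ h → to (AllPairs-toList _≺_ xs) (λ p q p<q → h (suc p) (suc q) z<s (s≤s p<q))) g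
    where
    g : Increasing (toList xs) → IncreasingAfter (y ∷ xs) zero
    g inc zero q () _
    g inc (suc p) zero _ ()
    g inc (suc p) (suc q) _ b = from (AllPairs-toList _≺_ xs) inc p q (s<s⁻¹ b)

  Cond : ∀ {L} → ℕ → Vec Ext L → Set
  Cond d x = CondC d c t x

  Indexed⇔DescentForm : ℕ → ∀ {n} → Vec Ext n → Set
  Indexed⇔DescentForm d x = (AtLeast (suc d) x × Cond (suc d) x) ⇔ DescentForm (suc d) (toList x)

  conditions-final : ∀ {n} y (xs : Vec Ext n) → Descent y (toList xs) → Indexed⇔DescentForm 0 (y ∷ xs)
  conditions-final y xs dy = mk⇔ f g
    where
    f : AtLeast 1 (y ∷ xs) × Cond 1 (y ∷ xs) → DescentForm 1 (y ∷ toList xs)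
    f (_ , cc) = final dy (to (IncreasingAfter-zero y xs) (cc zero (from (IsDescent-zero y xs) dy) (Exactly-none (y ∷ xs))))
    g : DescentForm 1 (y ∷ toList xs) → AtLeast 1 (y ∷ xs) × Cond 1 (y ∷ xs)
    g (plain ¬dy _) = ⊥-elim (¬dy dy)
    g (final _ inc) = ((λ _ → zero) , (λ { {zero} {zero} _ → refl }) , (λ _ → from (IsDescent-zero y xs) dy)) , cc
      where
      cc : Cond 1 (y ∷ xs)
      cc zero _ _ = from (IncreasingAfter-zero y xs) inc
      cc (suc i) _ ex = ⊥-elim (¬Exactly-zero-after-descent y xs i dy ex)

  conditions-descent : ∀ {n d} y (xs : Vec Ext n) → Descent y (toList xs) →
    Indexed⇔DescentForm d xs → Indexed⇔DescentForm (suc d) (y ∷ xs)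
  conditions-descent {d = d} y xs dy ih = mk⇔ f g
    where
    f : AtLeast (suc (suc d)) (y ∷ xs) × Cond (suc (suc d)) (y ∷ xs) → DescentForm (suc (suc d)) (y ∷ toList xs)
    f (al , cc) = descent dy (to ih (AtLeast-∷⁻ y xs al ,
      λ i di ex → to (IncreasingAfter-suc y xs i) (cc (suc i) (from (IsDescent-suc y xs i) di) (Exactly-∷⁺ y xs i dy ex))))
    g : DescentForm (suc (suc d)) (y ∷ toList xs) → AtLeast (suc (suc d)) (y ∷ xs) × Cond (suc (suc d)) (y ∷ xs)
    g (plain ¬dy _) = ⊥-elim (¬dy dy)
    g (descent _ sp) = AtLeast-∷⁺ y xs dy al , cc
      where
      al = proj₁ (from ih sp)
      cc : Cond (suc (suc d)) (y ∷ xs)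
      cc zero _ ex with Exactly-at-zero (y ∷ xs) ex
      ... | ()
      cc (suc i) di ex = from (IncreasingAfter-suc y xs i)
        (proj₂ (from ih sp) i (to (IsDescent-suc y xs i) di) (Exactly-∷⁻ y xs i dy ex))

  conditions-plain : ∀ {n d} y (xs : Vec Ext n) → ¬ Descent y (toList xs) →
    Indexed⇔DescentForm d xs → Indexed⇔DescentForm d (y ∷ xs)
  conditions-plain {d = d} y xs ¬dy ih = mk⇔ f g
    where
    f : AtLeast (suc d) (y ∷ xs) × Cond (suc d) (y ∷ xs) → DescentForm (suc d) (y ∷ toList xs)
    f (al , cc) = plain ¬dy (to ih (AtLeast-plain-∷⁻ y xs ¬dy al ,
      λ i di ex → to (IncreasingAfter-suc y xs i) (cc (suc i) (from (IsDescent-suc y xs i) di) (Exactly-plain-∷⁺ y xs i ¬dy ex))))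
    g : DescentForm (suc d) (y ∷ toList xs) → AtLeast (suc d) (y ∷ xs) × Cond (suc d) (y ∷ xs)
    g (final dy _) = ⊥-elim (¬dy dy)
    g (descent dy _) = ⊥-elim (¬dy dy)
    g (plain _ sp) = AtLeast-there y xs (proj₁ (from ih sp)) , cc
      where
      cc : Cond (suc d) (y ∷ xs)
      cc zero dz _ = ⊥-elim (¬dy (to (IsDescent-zero y xs) dz))
      cc (suc i) di ex = from (IncreasingAfter-suc y xs i)
        (proj₂ (from ih sp) i (to (IsDescent-suc y xs i) di) (Exactly-plain-∷⁻ y xs i ¬dy ex))

  indexed⇔DescentForm : ∀ d {n} (x : Vec Ext n) → Indexed⇔DescentForm d x
  indexed⇔DescentForm d [] = mk⇔ (λ { ((f , _) , _) → ⊥-elim (¬Fin0 (f zero)) }) (λ ())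
  indexed⇔DescentForm d (y ∷ xs) with Descent? y (toList xs)
  indexed⇔DescentForm zero (y ∷ xs) | yes dy = conditions-final y xs dy
  indexed⇔DescentForm (suc d) (y ∷ xs) | yes dy = conditions-descent y xs dy (indexed⇔DescentForm d xs)
  indexed⇔DescentForm d (y ∷ xs) | no ¬dy = conditions-plain y xs ¬dy (indexed⇔DescentForm d xs)

toList-seqλ : ∀ {n} (w : Vec ℕ n) → toList (seqλ w) ≡ nothing ∷ embed (toList w)
toList-seqλ w = cong (nothing ∷_) (toList-map just w)

module Conditions (c t : ℕ) (c≤t : c ≤ t) where
  open Descents c t
  open ThreeRuns c t c≤t
  open IndexedDescents c t

  CondA⇔IncreasingOnC₁ : ∀ {n} (w : Vec ℕ n) → CondA c t (seqλ w) ⇔ IncreasingOnC₁ (toList w)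
  CondA⇔IncreasingOnC₁ w = mk⇔ f g
    where
    R : Ext → Ext → Set
    R a b = InC₁ a → InC₁ b → a ≺ b
    pairs = AllPairs-toList R (seqλ w)
    f : CondA c t (seqλ w) → IncreasingOnC₁ (toList w)
    f ca with subst (AllPairs R) (toList-seqλ w) (to pairs ca)
    ... | _ ∷ ap = AP.map⁻ ap
    g : IncreasingOnC₁ (toList w) → CondA c t (seqλ w)
    g ac = from pairs (subst (AllPairs R) (sym (toList-seqλ w)) (All.tabulate (λ _ ()) ∷ AP.map⁺ ac))

  conditions⇔Conds : ∀ d {n} (w : Vec ℕ n) →
    (CondA c t (seqλ w) × AtLeastDescents (suc d) c t (seqλ w) × CondC (suc d) c t (seqλ w)) ⇔ Conds (suc d) nothing (toList w)
  conditions⇔Conds d w = mk⇔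
    (λ { (ca , al , cc) → to A ca , subst (DescentForm (suc d)) (toList-seqλ w) (to B (al , cc)) })
    (λ { (ac , sp) → let (al , cc) = from B (subst (DescentForm (suc d)) (sym (toList-seqλ w)) sp) in from A ac , al , cc })
    where
    A = CondA⇔IncreasingOnC₁ w
    B = indexed⇔DescentForm d (seqλ w)

range⁻ : ∀ {a len x} → x ∈ range a len → a ≤ x × x < a + len
range⁻ {a} {len} m with ∈-map⁻ (a +_) m
... | y , ym , refl = m≤m+n a y , +-monoʳ-< a (∈-upTo⁻ ym)

range⁺ : ∀ {a len x} → a ≤ x → x < a + len → x ∈ range a len
range⁺ {a} {len} {x} a≤x x<
  = subst (_∈ range a len) (m+[n∸m]≡n a≤x)
      (∈-map⁺ (a +_) (∈-upTo⁺ (+-cancelˡ-< a (x ∸ a) len (subst (_< a + len) (sym (m+[n∸m]≡n a≤x)) x<))))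

divC≈three : ∀ {n m r} a → r ≤ m → m ≤ n → (w : List ℕ) →
  (∀ {x} → x < n → x ∈ w) → (∀ {x} → x ∈ w → x < n) →
  divC n m r (3 + a) ≈D shapeDivision (three (n ∸ m) (n ∸ m + r) a (n ∸ (3 + a))) w
divC≈three {n} {m} {r} a r≤m m≤n w ∈w⁺ ∈w⁻ = lowBlock ∷≈ gaps-++-resp-≈D a (midBlock ∷≈ highBlock ∷≈ ≈D-refl)
  where
  c = n ∸ m
  t = n ∸ m + r
  t+[m∸r]≡n : t + (m ∸ r) ≡ n
  t+[m∸r]≡n = trans (+-assoc c r (m ∸ r)) (trans (cong (c +_) (m+[n∸m]≡n r≤m)) (m∸n+n≡m m≤n))
  t≤n : t ≤ n
  t≤n = subst (t ≤_) t+[m∸r]≡n (m≤m+n t (m ∸ r))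
  lowBlock : range 0 c ≋ below c w
  lowBlock = mk≋ (λ x xm → let (_ , x<c) = range⁻ {0} {c} xm in below⁺ c w (∈w⁺ (<-≤-trans x<c (m∸n≤m n m))) x<c)
            (λ x xm → let (_ , x<c) = below⁻ c w xm in range⁺ z≤n x<c)
  midBlock : range c r ≋ below t (atLeast c w)
  midBlock = mk≋ (λ x xm → let (c≤x , x<t) = range⁻ {c} {r} xm in
      below⁺ t _ (atLeast⁺ c w (∈w⁺ (<-≤-trans x<t t≤n)) c≤x) x<t)
            (λ x xm → let (q , x<t) = below⁻ t _ xm ; (_ , c≤x) = atLeast⁻ c w q in range⁺ c≤x x<t)
  highBlock : range t (m ∸ r) ≋ atLeast t w
  highBlock = mk≋ (λ x xm → let (t≤x , x<) = range⁻ {t} {m ∸ r} xm in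
      atLeast⁺ t w (∈w⁺ (subst (x <_) t+[m∸r]≡n x<)) t≤x)
             (λ x xm → let (x∈w , t≤x) = atLeast⁻ t w xm in range⁺ t≤x (subst (x <_) (sym t+[m∸r]≡n) (∈w⁻ x∈w)))

↭-upTo⇒Distinct : ∀ {n w} → w ↭ upTo n → Distinct w
↭-upTo⇒Distinct {n} perm = fromUnique (PSP.Unique-resp-↭ (setoid ℕ) (↭⇒↭ₛ (↭-sym perm)) (upTo⁺ n))
  where
  fromUnique : ∀ {w} → AllPairs _≢_ w → Distinct w
  fromUnique [] = tt
  fromUnique (a ∷ u) = (λ m → All.lookup a m refl) , fromUnique u

mainTheorem12 : (n m r k : ℕ) → r ≤ m → m ≤ n → 3 ≤ k → k ≤ n →
  (w : Vec ℕ n) → toList w ↭ upTo n →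
  IsCPerm (divC n m r k) (toList w) ⇔
  (CondA (n ∸ m) (n ∸ m + r) (seqλ w)
  × AtLeastDescents (k ∸ 1) (n ∸ m) (n ∸ m + r) (seqλ w)
  × CondC (k ∸ 1) (n ∸ m) (n ∸ m + r) (seqλ w))
mainTheorem12 n m r (suc (suc (suc a))) r≤m m≤n (s≤s (s≤s (s≤s _))) k≤n w perm =
  begin
    IsCPerm (divC n m r (3 + a)) (toList w)         ≈⟨ IsCPerm-cong (divC≈three a r≤m m≤n (toList w) ∈w⁺ ∈w⁻) ⟩
    IsCPerm (shapeDivision σ (toList w)) (toList w) ≈⟨ IsCPerm⇔Run σ (toList w) c≤t distinct ⟩
    Run σ (toList w)                                ≈⟨ three⇔ (toList w) a (n ∸ (3 + a)) nothing tt distinct length-w ⟩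
    Conds (2 + a) nothing (toList w)                ≈⟨ ⇔.sym (conditions⇔Conds (suc a) w) ⟩
    _                                               ∎
  where
  open SetoidReasoning (⇔.⇔-setoid 0ℓ)
  c = n ∸ m
  t = n ∸ m + r
  c≤t : c ≤ t
  c≤t = m≤m+n c r
  σ : Shape
  σ = three c t a (n ∸ (3 + a))
  open ThreeRuns c t c≤t
  open Conditions c t c≤t
  ∈w⁺ : ∀ {x} → x < n → x ∈ toList w
  ∈w⁺ x<n = ∈-resp-↭ (↭-sym perm) (∈-upTo⁺ x<n)
  ∈w⁻ : ∀ {x} → x ∈ toList w → x < n
  ∈w⁻ x∈w = ∈-upTo⁻ (∈-resp-↭ perm x∈w)
  distinct : Distinct (toList w)
  distinct = ↭-upTo⇒Distinct perm
  length-w : length (toList w) ≡ 3 + (a + (n ∸ (3 + a)))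
  length-w = trans (length-toList w) (sym (m+[n∸m]≡n k≤n))
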